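{- Let $\mathbb{C}$ be a ribbon category and $A$ a reflexive object of $\mathbb{C}$ (with isomorphism $\varphi:A\otimes A^*\to A$). If the functor $A\otimes(-):\mathbb{C}|_A\to\mathbb{C}|_A$ is faithful, then the functor $F:\mathbb{C}|_A\to\mathcal{I}_{\mathcal{A}}$ ($A^{\otimes m}\mapsto m$, $f\mapsto F(f)$) is faithful.
   Context: Ribbon category: a (strict) braided monoidal category with braid $\sigma_{X,Y}:X\otimes Y\to Y\otimes X$, natural twist isomorphism $\theta$ with $\theta_{X\otimes Y}=\sigma_{X,Y};(\theta_Y\otimes\theta_X);\sigma_{Y,X}$, every object $X$ having a chosen left dual $X^*$ with unit $\eta_X:I\to X\otimes X^*$, counit $\varepsilon_X:X^*\otimes X\to I$ satisfying the snake equations, and $(\theta_X)^*=\theta_{X^*}$; composition $f;g$ is diagrammatic. Trace: $\mathrm{Tr}^X_{U,V}(f)=(U\otimes\eta_X);(f\otimes X^*);(V\otimes(\sigma_{X,X^*};(X^*\otimes\theta_X);\varepsilon_X))$. A reflexive object is an object $A$ with an isomorphism $\varphi:A\otimes A^*\to A$; $\mathbb{C}|_A$ is the full subcategory on the objects $A^{\otimes m}$. $\mathbf{app}:=(\varphi^{ -1}\otimes A);(A\otimes\varepsilon_A)$; $\mathbf{lam}:=(A\otimes\eta_A);(A\otimes A\otimes\theta_{A^*}^{ -1});(A\otimes\sigma^{ -1}_{A^*,A});(\varphi\otimes A)$; $\mathbf{app}_0=\mathrm{id}_A$, $\mathbf{app}_{n+1}=(\mathbf{app}\otimes A^{\otimes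 n});\mathbf{app}_n$; $\mathbf{lam}_0=\mathrm{id}_A$, $\mathbf{lam}_{m+1}=\mathbf{lam}_m;(\mathbf{lam}\otimes A^{\otimes m})$; for $f:A^{\otimes m}\to A^{\otimes n}$, $F(f):=\mathrm{Tr}^A_{I,A}(\mathbf{lam}_m;(\mathbf{lam}\otimes f);(A\otimes\mathbf{app}_n)):I\to A$. Let $\mathcal{A}=\mathbb{C}(I,A)$ with application $a\,b:=(a\otimes b);\mathbf{app}$ (left-associative) and $\mathbf{B}:=F(\mathbf{app})$, $\mathbf{C}^+:=F(\sigma_{A,A})$, $\mathbf{I}:=F(\mathrm{id}_I)$; write $a\circ b:=\mathbf{B}\,a\,b$, $a^0:=\mathbf{I}$, $a^{n+1}:=a\circ a^n$, $a^\bullet:=\mathbf{C}^+\,\mathbf{I}\,a$; $a$ has arity $m\to n$ if $a^\bullet\circ\mathbf{B}^{m+1}=(\mathbf{B}\,a)\circ\mathbf{B}^n$. The internal PROB $\mathcal{I}_{\mathcal{A}}$ has objects the natural numbers, morphisms $m\to n$ the elements of arity $m\to n$, composition $a\circ b$ (diagrammatic) and identities $\mathbf{I}$; $f\mapsto F(f)$ is a functor $\mathbb{C}|_A\to\mathcal{I}_{\mathcal{A}}$. Faithful means injective on each hom-set. -}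

module Defs where

open import Level using (Level; _⊔_)
open import Data.Nat using (ℕ; zero; suc)
open import Relation.Binary using (Rel; IsEquivalence)
open import Relation.Binary.PropositionalEquality using (_≡_; refl; sym; subst)

-- Strictness: the monoidal structure on objects satisfies associativity
-- and unit laws up to propositional equality (≡) of objects; morphisms
-- are transported along these equalities by `cast` (identity morphism
-- transported along the equality).
-- Composition _︔_ is diagrammatic: f ︔ g = "first f, then g".

record StrictRibbonCategory (o ℓ e : Level) : Set (Level.suc (o ⊔ ℓ ⊔ e)) where
  infixr 9 _︔_
  infixr 10 _⊗₀_ _⊗₁_
  infix  4 _≈_
  field
    Obj   : Set o
    _⇒_   : Obj → Obj → Set ℓ
    _≈_   : ∀ {X Y} → Rel (X ⇒ Y) e
    ≈-equiv : ∀ {X Y} → IsEquivalence (_≈_ {X} {Y})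
    id    : ∀ {X} → X ⇒ X
    _︔_   : ∀ {X Y Z} → X ⇒ Y → Y ⇒ Z → X ⇒ Z
    ︔-assoc : ∀ {W X Y Z} {f : W ⇒ X} {g : X ⇒ Y} {h : Y ⇒ Z} →
              (f ︔ g) ︔ h ≈ f ︔ (g ︔ h)
    ︔-idˡ  : ∀ {X Y} {f : X ⇒ Y} → id ︔ f ≈ f
    ︔-idʳ  : ∀ {X Y} {f : X ⇒ Y} → f ︔ id ≈ f
    ︔-resp : ∀ {X Y Z} {f f′ : X ⇒ Y} {g g′ : Y ⇒ Z} →
              f ≈ f′ → g ≈ g′ → f ︔ g ≈ f′ ︔ g′

  cast : ∀ {X Y} → X ≡ Y → X ⇒ Y
  cast {X} p = subst (λ Z → X ⇒ Z) p id

  field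
    I     : Obj
    _⊗₀_  : Obj → Obj → Obj
    ⊗-assoc₀ : ∀ {X Y Z} → (X ⊗₀ Y) ⊗₀ Z ≡ X ⊗₀ (Y ⊗₀ Z)
    ⊗-unitˡ₀ : ∀ {X} → I ⊗₀ X ≡ X
    ⊗-unitʳ₀ : ∀ {X} → X ⊗₀ I ≡ X
    _⊗₁_  : ∀ {X Y Z W} → X ⇒ Y → Z ⇒ W → (X ⊗₀ Z) ⇒ (Y ⊗₀ W)
    ⊗-id   : ∀ {X Y} → id {X} ⊗₁ id {Y} ≈ id
    ⊗-︔    : ∀ {X₁ X₂ X₃ Y₁ Y₂ Y₃} {f : X₁ ⇒ X₂} {g : X₂ ⇒ X₃}
               {h : Y₁ ⇒ Y₂} {k : Y₂ ⇒ Y₃} →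
             (f ︔ g) ⊗₁ (h ︔ k) ≈ (f ⊗₁ h) ︔ (g ⊗₁ k)
    ⊗-resp : ∀ {X Y Z W} {f f′ : X ⇒ Y} {g g′ : Z ⇒ W} →
             f ≈ f′ → g ≈ g′ → f ⊗₁ g ≈ f′ ⊗₁ g′
    ⊗-assoc₁ : ∀ {X Y Z X′ Y′ Z′} {f : X ⇒ X′} {g : Y ⇒ Y′} {h : Z ⇒ Z′} →
               ((f ⊗₁ g) ⊗₁ h) ︔ cast ⊗-assoc₀ ≈ cast ⊗-assoc₀ ︔ (f ⊗₁ (g ⊗₁ h))
    ⊗-unitˡ₁ : ∀ {X Y} {f : X ⇒ Y} → (id {I} ⊗₁ f) ︔ cast ⊗-unitˡ₀ ≈ cast ⊗-unitˡ₀ ︔ f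
    ⊗-unitʳ₁ : ∀ {X Y} {f : X ⇒ Y} → (f ⊗₁ id {I}) ︔ cast ⊗-unitʳ₀ ≈ cast ⊗-unitʳ₀ ︔ f

    σ      : ∀ X Y → (X ⊗₀ Y) ⇒ (Y ⊗₀ X)
    σ⁻¹    : ∀ X Y → (Y ⊗₀ X) ⇒ (X ⊗₀ Y)
    σ-isoˡ : ∀ {X Y} → σ X Y ︔ σ⁻¹ X Y ≈ id
    σ-isoʳ : ∀ {X Y} → σ⁻¹ X Y ︔ σ X Y ≈ id
    σ-natural : ∀ {X Y X′ Y′} {f : X ⇒ X′} {g : Y ⇒ Y′} →
                (f ⊗₁ g) ︔ σ X′ Y′ ≈ σ X Y ︔ (g ⊗₁ f)
    hexagon₁ : ∀ {X Y Z} →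
               σ X (Y ⊗₀ Z) ≈
                 cast (sym ⊗-assoc₀) ︔ (σ X Y ⊗₁ id {Z}) ︔ cast ⊗-assoc₀
                 ︔ (id {Y} ⊗₁ σ X Z) ︔ cast (sym ⊗-assoc₀)
    hexagon₂ : ∀ {X Y Z} →
               σ (X ⊗₀ Y) Z ≈
                 cast ⊗-assoc₀ ︔ (id {X} ⊗₁ σ Y Z) ︔ cast (sym ⊗-assoc₀)
                 ︔ (σ X Z ⊗₁ id {Y}) ︔ cast ⊗-assoc₀

    _* : Obj → Obj
    η  : ∀ X → I ⇒ (X ⊗₀ (X *))
    ε  : ∀ X → ((X *) ⊗₀ X) ⇒ I
    snake₁ : ∀ {X} →
             cast (sym ⊗-unitˡ₀) ︔ (η X ⊗₁ id {X}) ︔ cast ⊗-assoc₀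
             ︔ (id {X} ⊗₁ ε X) ︔ cast ⊗-unitʳ₀ ≈ id
    snake₂ : ∀ {X} →
             cast (sym ⊗-unitʳ₀) ︔ (id {X *} ⊗₁ η X) ︔ cast (sym ⊗-assoc₀)
             ︔ (ε X ⊗₁ id {X *}) ︔ cast ⊗-unitˡ₀ ≈ id

  dual : ∀ {X Y} → X ⇒ Y → (Y *) ⇒ (X *)
  dual {X} {Y} f =
    cast (sym ⊗-unitʳ₀) ︔ (id {Y *} ⊗₁ η X) ︔ (id {Y *} ⊗₁ (f ⊗₁ id {X *}))
    ︔ cast (sym ⊗-assoc₀) ︔ (ε Y ⊗₁ id {X *}) ︔ cast ⊗-unitˡ₀

  field
    θ      : ∀ X → X ⇒ X
    θ⁻¹    : ∀ X → X ⇒ X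
    θ-isoˡ : ∀ {X} → θ X ︔ θ⁻¹ X ≈ id
    θ-isoʳ : ∀ {X} → θ⁻¹ X ︔ θ X ≈ id
    θ-natural : ∀ {X Y} {f : X ⇒ Y} → f ︔ θ Y ≈ θ X ︔ f
    θ-balance : ∀ {X Y} → θ (X ⊗₀ Y) ≈ σ X Y ︔ (θ Y ⊗₁ θ X) ︔ σ Y X
    θ-dual    : ∀ {X} → dual (θ X) ≈ θ (X *)

  Tr : ∀ {U V} X → (U ⊗₀ X) ⇒ (V ⊗₀ X) → U ⇒ V
  Tr {U} {V} X f =
    cast (sym ⊗-unitʳ₀) ︔ (id {U} ⊗₁ η X) ︔ cast (sym ⊗-assoc₀)
    ︔ (f ⊗₁ id {X *}) ︔ cast ⊗-assoc₀
    ︔ (id {V} ⊗₁ (σ X (X *) ︔ (id {X *} ⊗₁ θ X) ︔ ε X))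
    ︔ cast ⊗-unitʳ₀

record ReflexiveObject {o ℓ e} (𝒞 : StrictRibbonCategory o ℓ e) : Set (o ⊔ ℓ ⊔ e) where
  open StrictRibbonCategory 𝒞
  field
    A     : Obj
    φ     : (A ⊗₀ (A *)) ⇒ A
    φ⁻¹   : A ⇒ (A ⊗₀ (A *))
    φ-isoˡ : φ ︔ φ⁻¹ ≈ id
    φ-isoʳ : φ⁻¹ ︔ φ ≈ id

module Reflexive {o ℓ e} (𝒞 : StrictRibbonCategory o ℓ e) (R : ReflexiveObject 𝒞) where
  open StrictRibbonCategory 𝒞
  open ReflexiveObject R

  A^ : ℕ → Obj
  A^ zero    = I
  A^ (suc m) = A ⊗₀ A^ m

  app : (A ⊗₀ A) ⇒ A
  app = (φ⁻¹ ⊗₁ id {A}) ︔ cast ⊗-assoc₀ ︔ (id {A} ⊗₁ ε A) ︔ cast ⊗-unitʳ₀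

  lam : A ⇒ (A ⊗₀ A)
  lam = cast (sym ⊗-unitʳ₀) ︔ (id {A} ⊗₁ η A)
        ︔ (id {A} ⊗₁ (id {A} ⊗₁ θ⁻¹ (A *)))
        ︔ (id {A} ⊗₁ σ⁻¹ (A *) A)
        ︔ cast (sym ⊗-assoc₀) ︔ (φ ⊗₁ id {A})

  -- app_n : A^{⊗(n+1)} → A   (app_0 = id_A, up to the strictness cast A⊗I = A)
  appₙ : ∀ n → A^ (suc n) ⇒ A
  appₙ zero    = cast ⊗-unitʳ₀
  appₙ (suc n) = cast (sym ⊗-assoc₀) ︔ (app ⊗₁ id {A^ n}) ︔ appₙ n

  -- lam_m : A → A^{⊗(m+1)}   (lam_0 = id_A, up to the strictness cast A = A⊗I)
  lamₘ : ∀ m → A ⇒ A^ (suc m)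
  lamₘ zero    = cast (sym ⊗-unitʳ₀)
  lamₘ (suc m) = lamₘ m ︔ (lam ⊗₁ id {A^ m}) ︔ cast ⊗-assoc₀

  F : ∀ {m n} → A^ m ⇒ A^ n → I ⇒ A
  F {m} {n} f =
    Tr A (cast ⊗-unitˡ₀ ︔ lamₘ m ︔ (lam ⊗₁ f) ︔ cast ⊗-assoc₀ ︔ (id {A} ⊗₁ appₙ n))

  A⊗-Faithful : Set (ℓ ⊔ e)
  A⊗-Faithful = ∀ m n (f g : A^ m ⇒ A^ n) → id {A} ⊗₁ f ≈ id {A} ⊗₁ g → f ≈ g

  F-Faithful : Set (ℓ ⊔ e)
  F-Faithful = ∀ m n (f g : A^ m ⇒ A^ n) → F {m} {n} f ≈ F {m} {n} g → f ≈ g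

-- F f is, up to unit and associativity casts, the trace of lamₘ (m + 1) ; (A ⊗ body f), where
-- body f = (A ⊗ f) ; appₙ n.  Feeding lam into app across a braiding yields the twist θ A
-- (a curl identity of the ribbon structure), so applying such a trace to a generic argument
-- removes one abstraction and only rearranges the remaining inputs invertibly.  Iterating this
-- and closing with a snake identity shows that F f determines body f.  In turn body f
-- determines A ⊗ f: precomposing body f with an n-fold abstraction whose arguments are routed
-- into the counit ε (A^ n) gives A ⊗ ((id ⊗ f) ; ε (A^ n)), and a second snake identity,
-- conjugated by the braiding past A, recovers A ⊗ f.  Faithfulness of A ⊗ (-) concludes.

{-# OPTIONS --safe #-}
module Submission where

open import Level using (_⊔_)
open import Data.Nat using (zero; suc)
open import Data.Product using (Σ-syntax; _,_; proj₁; proj₂)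
open import Relation.Binary using (IsEquivalence)
open import Relation.Binary.PropositionalEquality using (_≡_; refl; sym; trans; cong; cong₂)
open import Defs

module MonoidalReasoning {o ℓ e} (𝒞 : StrictRibbonCategory o ℓ e) where
  open StrictRibbonCategory 𝒞 public

  private
    module ≈ {X Y} = IsEquivalence (≈-equiv {X} {Y})
    variable
      X Y Z W X′ Y′ Z′ W′ : Obj

  infixr 4 _∙_

  ≈-refl : {f : X ⇒ Y} → f ≈ f
  ≈-refl = ≈.refl

  ≈-sym : {f g : X ⇒ Y} → f ≈ g → g ≈ f
  ≈-sym = ≈.sym

  _∙_ : {f g h : X ⇒ Y} → f ≈ g → g ≈ h → f ≈ h
  _∙_ = ≈.trans

  refl⟩︔⟨_ : {f : X ⇒ Y} {g g′ : Y ⇒ Z} → g ≈ g′ → f ︔ g ≈ f ︔ g′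
  refl⟩︔⟨ p = ︔-resp ≈-refl p

  _⟩︔⟨refl : {f f′ : X ⇒ Y} {g : Y ⇒ Z} → f ≈ f′ → f ︔ g ≈ f′ ︔ g
  p ⟩︔⟨refl = ︔-resp p ≈-refl

  refl⟩⊗⟨_ : {f : X ⇒ Y} {g g′ : Z ⇒ W} → g ≈ g′ → f ⊗₁ g ≈ f ⊗₁ g′
  refl⟩⊗⟨ p = ⊗-resp ≈-refl p

  _⟩⊗⟨refl : {f f′ : X ⇒ Y} {g : Z ⇒ W} → f ≈ f′ → f ⊗₁ g ≈ f′ ⊗₁ g
  p ⟩⊗⟨refl = ⊗-resp p ≈-refl

  sym-assoc : {f : X ⇒ Y} {g : Y ⇒ Z} {h : Z ⇒ W} → f ︔ (g ︔ h) ≈ (f ︔ g) ︔ h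
  sym-assoc = ≈-sym ︔-assoc

  pullˡ : {f : X ⇒ Y} {g : Y ⇒ Z} {h : X ⇒ Z} {k : Z ⇒ W} →
          f ︔ g ≈ h → f ︔ (g ︔ k) ≈ h ︔ k
  pullˡ p = sym-assoc ∙ p ⟩︔⟨refl

  extendˡ : {f : X ⇒ Y} {g : Y ⇒ Z} {f′ : X ⇒ Y′} {g′ : Y′ ⇒ Z} {k : Z ⇒ W} →
            f ︔ g ≈ f′ ︔ g′ → f ︔ (g ︔ k) ≈ f′ ︔ (g′ ︔ k)
  extendˡ p = pullˡ p ∙ ︔-assoc

  cancelˡ : {f : X ⇒ Y} {g : Y ⇒ X} {k : X ⇒ Z} → f ︔ g ≈ id → f ︔ (g ︔ k) ≈ k
  cancelˡ p = pullˡ p ∙ ︔-idˡ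

  ︔-cancelˡ : {f : X ⇒ Y} {g : Y ⇒ X} {h h′ : Y ⇒ Z} → g ︔ f ≈ id → f ︔ h ≈ f ︔ h′ → h ≈ h′
  ︔-cancelˡ gf p = ≈-sym (cancelˡ gf) ∙ refl⟩︔⟨ p ∙ cancelˡ gf

  ︔-cancelʳ : {f : Y ⇒ Z} {g : Z ⇒ Y} {h h′ : X ⇒ Y} → f ︔ g ≈ id → h ︔ f ≈ h′ ︔ f → h ≈ h′
  ︔-cancelʳ fg p = ≈-sym (refl⟩︔⟨ fg ∙ ︔-idʳ) ∙ sym-assoc ∙ p ⟩︔⟨refl ∙ ︔-assoc ∙ refl⟩︔⟨ fg ∙ ︔-idʳ

  transpose-square : {c : X ⇒ X′} {c′ : X′ ⇒ X} {d : Y ⇒ Y′} {d′ : Y′ ⇒ Y}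
                     {f : X ⇒ Y} {g : X′ ⇒ Y′} →
                     d ︔ d′ ≈ id → c′ ︔ c ≈ id → f ︔ d ≈ c ︔ g → c′ ︔ f ≈ g ︔ d′
  transpose-square dd′ c′c sq =
    refl⟩︔⟨ (≈-sym ︔-idʳ ∙ refl⟩︔⟨ ≈-sym dd′ ∙ sym-assoc ∙ sq ⟩︔⟨refl ∙ ︔-assoc)
    ∙ cancelˡ c′c

  id⊗-︔ : {f : Y ⇒ Z} {g : Z ⇒ W} → id {X} ⊗₁ (f ︔ g) ≈ (id ⊗₁ f) ︔ (id ⊗₁ g)
  id⊗-︔ = ≈-sym ︔-idˡ ⟩⊗⟨refl ∙ ⊗-︔

  ︔-⊗id : {f : Y ⇒ Z} {g : Z ⇒ W} → (f ︔ g) ⊗₁ id {X} ≈ (f ⊗₁ id) ︔ (g ⊗₁ id)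
  ︔-⊗id = refl⟩⊗⟨ ≈-sym ︔-idˡ ∙ ⊗-︔

  ⊗≈⊗id︔id⊗ : {f : X ⇒ Y} {g : Z ⇒ W} → f ⊗₁ g ≈ (f ⊗₁ id) ︔ (id ⊗₁ g)
  ⊗≈⊗id︔id⊗ = ⊗-resp (≈-sym ︔-idʳ) (≈-sym ︔-idˡ) ∙ ⊗-︔

  ⊗≈id⊗︔⊗id : {f : X ⇒ Y} {g : Z ⇒ W} → f ⊗₁ g ≈ (id ⊗₁ g) ︔ (f ⊗₁ id)
  ⊗≈id⊗︔⊗id = ⊗-resp (≈-sym ︔-idˡ) (≈-sym ︔-idʳ) ∙ ⊗-︔

  interchange : {f : X ⇒ Y} {g : Z ⇒ W} → (f ⊗₁ id) ︔ (id ⊗₁ g) ≈ (id ⊗₁ g) ︔ (f ⊗₁ id)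
  interchange = ≈-sym ⊗≈⊗id︔id⊗ ∙ ⊗≈id⊗︔⊗id

  id⊗-inverse : {f : Y ⇒ Z} {g : Z ⇒ Y} → f ︔ g ≈ id → (id {X} ⊗₁ f) ︔ (id ⊗₁ g) ≈ id
  id⊗-inverse p = ≈-sym id⊗-︔ ∙ refl⟩⊗⟨ p ∙ ⊗-id

  ⊗id-inverse : {f : Y ⇒ Z} {g : Z ⇒ Y} → f ︔ g ≈ id → (f ⊗₁ id {X}) ︔ (g ⊗₁ id) ≈ id
  ⊗id-inverse p = ≈-sym ︔-⊗id ∙ p ⟩⊗⟨refl ∙ ⊗-id

  record IsCast (c : X ⇒ Y) : Set (o ⊔ e) where
    constructor is-cast
    field
      obj-eq : X ≡ Y
      ≈-cast : c ≈ cast obj-eq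
  open IsCast public

  cast-irrelevant : (p q : X ≡ Y) → cast p ≈ cast q
  cast-irrelevant refl refl = ≈-refl

  cast-︔ : (p : X ≡ Y) (q : Y ≡ Z) → cast p ︔ cast q ≈ cast (trans p q)
  cast-︔ refl refl = ︔-idˡ

  cast-⊗ : (p : X ≡ X′) (q : Y ≡ Y′) → cast p ⊗₁ cast q ≈ cast (cong₂ _⊗₀_ p q)
  cast-⊗ refl refl = ⊗-id

  casts-equal : {c d : X ⇒ Y} → IsCast c → IsCast d → c ≈ d
  casts-equal (is-cast p c≈) (is-cast q d≈) = c≈ ∙ cast-irrelevant p q ∙ ≈-sym d≈

  cast-IsCast : (p : X ≡ Y) → IsCast (cast p)
  cast-IsCast p = is-cast p ≈-refl

  id-IsCast : IsCast (id {X})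
  id-IsCast = is-cast refl ≈-refl

  infixr 9 _︔-IsCast_
  infixr 10 _⊗-IsCast_

  _︔-IsCast_ : {c : X ⇒ Y} {d : Y ⇒ Z} → IsCast c → IsCast d → IsCast (c ︔ d)
  is-cast p c≈ ︔-IsCast is-cast q d≈ = is-cast (trans p q) (︔-resp c≈ d≈ ∙ cast-︔ p q)

  _⊗-IsCast_ : {c : X ⇒ Y} {d : Z ⇒ W} → IsCast c → IsCast d → IsCast (c ⊗₁ d)
  is-cast p c≈ ⊗-IsCast is-cast q d≈ = is-cast (cong₂ _⊗₀_ p q) (⊗-resp c≈ d≈ ∙ cast-⊗ p q)

  cast-inverse : {c : X ⇒ Y} {d : Y ⇒ X} → IsCast c → IsCast d → c ︔ d ≈ id
  cast-inverse c d = casts-equal (c ︔-IsCast d) id-IsCast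

  α⇒ : ((X ⊗₀ Y) ⊗₀ Z) ⇒ (X ⊗₀ (Y ⊗₀ Z))
  α⇒ = cast ⊗-assoc₀
  α⇐ : (X ⊗₀ (Y ⊗₀ Z)) ⇒ ((X ⊗₀ Y) ⊗₀ Z)
  α⇐ = cast (sym ⊗-assoc₀)
  λ⇒ : (I ⊗₀ X) ⇒ X
  λ⇒ = cast ⊗-unitˡ₀
  λ⇐ : X ⇒ (I ⊗₀ X)
  λ⇐ = cast (sym ⊗-unitˡ₀)
  ρ⇒ : (X ⊗₀ I) ⇒ X
  ρ⇒ = cast ⊗-unitʳ₀
  ρ⇐ : X ⇒ (X ⊗₀ I)
  ρ⇐ = cast (sym ⊗-unitʳ₀)

  α⇒-IsCast : IsCast (α⇒ {X} {Y} {Z})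
  α⇒-IsCast = cast-IsCast _
  α⇐-IsCast : IsCast (α⇐ {X} {Y} {Z})
  α⇐-IsCast = cast-IsCast _
  λ⇒-IsCast : IsCast (λ⇒ {X})
  λ⇒-IsCast = cast-IsCast _
  λ⇐-IsCast : IsCast (λ⇐ {X})
  λ⇐-IsCast = cast-IsCast _
  ρ⇒-IsCast : IsCast (ρ⇒ {X})
  ρ⇒-IsCast = cast-IsCast _
  ρ⇐-IsCast : IsCast (ρ⇐ {X})
  ρ⇐-IsCast = cast-IsCast _

  α⇐-natural : {f : X ⇒ X′} {g : Y ⇒ Y′} {h : Z ⇒ Z′} →
               α⇐ ︔ ((f ⊗₁ g) ⊗₁ h) ≈ (f ⊗₁ (g ⊗₁ h)) ︔ α⇐
  α⇐-natural = transpose-square (cast-inverse α⇒-IsCast α⇐-IsCast)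
                                (cast-inverse α⇐-IsCast α⇒-IsCast) ⊗-assoc₁

  λ⇐-natural : {f : X ⇒ Y} → λ⇐ ︔ (id {I} ⊗₁ f) ≈ f ︔ λ⇐
  λ⇐-natural = transpose-square (cast-inverse λ⇒-IsCast λ⇐-IsCast)
                                (cast-inverse λ⇐-IsCast λ⇒-IsCast) ⊗-unitˡ₁

  -- ⊗ is strict only up to ≡ of objects, so most equations hold only after transport along
  -- such equalities; f ≋ g is this relation between morphisms of possibly different types.
  infix 4 _≋_
  record _≋_ (f : X ⇒ Y) (g : X′ ⇒ Y′) : Set (o ⊔ e) where
    constructor mk-≋
    field
      dom-eq : X ≡ X′
      cod-eq : Y ≡ Y′
      square : f ︔ cast cod-eq ≈ cast dom-eq ︔ g

  ≈⇒≋ : {f g : X ⇒ Y} → f ≈ g → f ≋ g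
  ≈⇒≋ p = mk-≋ refl refl (︔-idʳ ∙ p ∙ ≈-sym ︔-idˡ)

  ≋⇒≈ : {f g : X ⇒ Y} → f ≋ g → f ≈ g
  ≋⇒≈ (mk-≋ refl refl sq) = ≈-sym ︔-idʳ ∙ sq ∙ ︔-idˡ

  ≋-refl : {f : X ⇒ Y} → f ≋ f
  ≋-refl = ≈⇒≋ ≈-refl

  ≋-sym : {f : X ⇒ Y} {g : X′ ⇒ Y′} → f ≋ g → g ≋ f
  ≋-sym p@(mk-≋ refl refl _) = ≈⇒≋ (≈-sym (≋⇒≈ p))

  infixr 4 _⊙_
  _⊙_ : {f : X ⇒ Y} {g : X′ ⇒ Y′} {h : Z ⇒ W} → f ≋ g → g ≋ h → f ≋ h
  mk-≋ refl refl p ⊙ mk-≋ refl refl q = mk-≋ refl refl (p ∙ ︔-idˡ ∙ ≈-sym ︔-idʳ ∙ q)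

  infixr 9 _︔≋_
  _︔≋_ : {f : X ⇒ Y} {g : Y ⇒ Z} {f′ : X′ ⇒ Y′} {g′ : Y′ ⇒ Z′} →
         f ≋ f′ → g ≋ g′ → (f ︔ g) ≋ (f′ ︔ g′)
  p@(mk-≋ refl refl _) ︔≋ q@(mk-≋ refl refl _) = ≈⇒≋ (︔-resp (≋⇒≈ p) (≋⇒≈ q))

  infixr 10 _⊗≋_
  _⊗≋_ : {f : X ⇒ Y} {g : Z ⇒ W} {f′ : X′ ⇒ Y′} {g′ : Z′ ⇒ W′} →
         f ≋ f′ → g ≋ g′ → (f ⊗₁ g) ≋ (f′ ⊗₁ g′)
  p@(mk-≋ refl refl _) ⊗≋ q@(mk-≋ refl refl _) = ≈⇒≋ (⊗-resp (≋⇒≈ p) (≋⇒≈ q))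

  infix  1 begin≋_
  infixr 2 _≋⟨_⟩_
  infix  3 _≋∎

  begin≋_ : {f : X ⇒ Y} {g : X′ ⇒ Y′} → f ≋ g → f ≋ g
  begin≋ p = p

  _≋⟨_⟩_ : (f : X ⇒ Y) {g : X′ ⇒ Y′} {h : Z ⇒ W} → f ≋ g → g ≋ h → f ≋ h
  f ≋⟨ p ⟩ q = p ⊙ q

  _≋∎ : (f : X ⇒ Y) → f ≋ f
  f ≋∎ = ≋-refl

  assoc-≋ : {f : X ⇒ Y} {g : Y ⇒ Z} {h : Z ⇒ W} → ((f ︔ g) ︔ h) ≋ (f ︔ (g ︔ h))
  assoc-≋ = ≈⇒≋ ︔-assoc

  sym-assoc-≋ : {f : X ⇒ Y} {g : Y ⇒ Z} {h : Z ⇒ W} → (f ︔ (g ︔ h)) ≋ ((f ︔ g) ︔ h)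
  sym-assoc-≋ = ≈⇒≋ sym-assoc

  id≋id : X ≡ Y → id {X} ≋ id {Y}
  id≋id refl = ≋-refl

  cast≋id : (p : X ≡ Y) → cast p ≋ id {Y}
  cast≋id refl = ≋-refl

  cast≋id′ : (p : X ≡ Y) → cast p ≋ id {X}
  cast≋id′ refl = ≋-refl

  IsCast⇒≋id : {c : X ⇒ Y} → IsCast c → c ≋ id {Y}
  IsCast⇒≋id (is-cast p c≈) = ≈⇒≋ c≈ ⊙ cast≋id p

  IsCast⇒≋id′ : {c : X ⇒ Y} → IsCast c → c ≋ id {X}
  IsCast⇒≋id′ (is-cast p c≈) = ≈⇒≋ c≈ ⊙ cast≋id′ p

  ≋id⇒IsCast : {c : X ⇒ Y} → c ≋ id {Z} → IsCast c
  ≋id⇒IsCast p@(mk-≋ refl refl _) = is-cast refl (≋⇒≈ p)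

  casts-≋ : {c : X ⇒ Y} {d : X′ ⇒ Y′} → IsCast c → IsCast d → X ≡ X′ → c ≋ d
  casts-≋ c d refl = IsCast⇒≋id′ c ⊙ ≋-sym (IsCast⇒≋id′ d)

  dropˡ : {c : X ⇒ Y} {f : Y ⇒ Z} → c ≋ id {Y} → (c ︔ f) ≋ f
  dropˡ p = (p ︔≋ ≋-refl) ⊙ ≈⇒≋ ︔-idˡ

  dropʳ : {c : Y ⇒ Z} {f : X ⇒ Y} → c ≋ id {Y} → (f ︔ c) ≋ f
  dropʳ p = (≋-refl ︔≋ p) ⊙ ≈⇒≋ ︔-idʳ

  cast-dropˡ : {c : X ⇒ Y} {f : Y ⇒ Z} → IsCast c → (c ︔ f) ≋ f
  cast-dropˡ c = dropˡ (IsCast⇒≋id c)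

  cast-dropʳ : {c : Y ⇒ Z} {f : X ⇒ Y} → IsCast c → (f ︔ c) ≋ f
  cast-dropʳ c = dropʳ (IsCast⇒≋id′ c)

  ⊗-assoc-≋ : {f : X ⇒ X′} {g : Y ⇒ Y′} {h : Z ⇒ Z′} → ((f ⊗₁ g) ⊗₁ h) ≋ (f ⊗₁ (g ⊗₁ h))
  ⊗-assoc-≋ = mk-≋ ⊗-assoc₀ ⊗-assoc₀ ⊗-assoc₁

  ⊗-sym-assoc-≋ : {f : X ⇒ X′} {g : Y ⇒ Y′} {h : Z ⇒ Z′} → (f ⊗₁ (g ⊗₁ h)) ≋ ((f ⊗₁ g) ⊗₁ h)
  ⊗-sym-assoc-≋ = ≋-sym ⊗-assoc-≋

  unitˡ-≋ : {f : X ⇒ Y} → (id {I} ⊗₁ f) ≋ f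
  unitˡ-≋ = mk-≋ ⊗-unitˡ₀ ⊗-unitˡ₀ ⊗-unitˡ₁

  unitʳ-≋ : {f : X ⇒ Y} → (f ⊗₁ id {I}) ≋ f
  unitʳ-≋ = mk-≋ ⊗-unitʳ₀ ⊗-unitʳ₀ ⊗-unitʳ₁

  ⊗-id-≋ : (id {X} ⊗₁ id {Y}) ≋ id {X ⊗₀ Y}
  ⊗-id-≋ = ≈⇒≋ ⊗-id

  id⊗-︔-≋ : {f : Y ⇒ Z} {g : Z ⇒ W} → (id {X} ⊗₁ (f ︔ g)) ≋ ((id ⊗₁ f) ︔ (id ⊗₁ g))
  id⊗-︔-≋ = ≈⇒≋ id⊗-︔

  ︔-⊗id-≋ : {f : Y ⇒ Z} {g : Z ⇒ W} → ((f ︔ g) ⊗₁ id {X}) ≋ ((f ⊗₁ id) ︔ (g ⊗₁ id))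
  ︔-⊗id-≋ = ≈⇒≋ ︔-⊗id

  ≋-inverse : {f : X ⇒ Y} {f′ : Y ⇒ X} {g : X′ ⇒ Y′} {g′ : Y′ ⇒ X′} →
              f ≋ g → f ︔ f′ ≈ id → g′ ︔ g ≈ id → f′ ≋ g′
  ≋-inverse f≋g@(mk-≋ refl refl _) ff′ g′g =
    ≈⇒≋ (≈-sym ︔-idˡ ∙ ≈-sym g′g ⟩︔⟨refl ∙ ︔-assoc
         ∙ refl⟩︔⟨ (≈-sym (≋⇒≈ f≋g) ⟩︔⟨refl ∙ ff′) ∙ ︔-idʳ)

  idempotent-invertible⇒id : {t u : X ⇒ X} → t ≈ t ︔ t → t ︔ u ≈ id → t ≈ id
  idempotent-invertible⇒id {t = t} {u} tt tu =
    ≈-sym (≈-sym tu ∙ tt ⟩︔⟨refl ∙ ︔-assoc ∙ refl⟩︔⟨ tu ∙ ︔-idʳ)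

module RibbonLemmas {o ℓ e} (𝒞 : StrictRibbonCategory o ℓ e) where
  open MonoidalReasoning 𝒞 public

  private
    variable
      X Y Z W X′ Y′ Z′ W′ : Obj

  σ-≋ : X ≡ X′ → Y ≡ Y′ → σ X Y ≋ σ X′ Y′
  σ-≋ refl refl = ≋-refl

  θ-≋ : X ≡ X′ → θ X ≋ θ X′
  θ-≋ refl = ≋-refl

  σ⁻¹-natural : {f : X ⇒ X′} {g : Y ⇒ Y′} → (g ⊗₁ f) ︔ σ⁻¹ X′ Y′ ≈ σ⁻¹ X Y ︔ (f ⊗₁ g)
  σ⁻¹-natural = ≈-sym (transpose-square σ-isoˡ σ-isoʳ σ-natural)

  hexagon₁-≋ : σ X (Y ⊗₀ Z) ≋ (σ X Y ⊗₁ id {Z}) ︔ α⇒ ︔ (id {Y} ⊗₁ σ X Z)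
  hexagon₁-≋ = ≈⇒≋ hexagon₁ ⊙ cast-dropˡ α⇐-IsCast
             ⊙ (≋-refl ︔≋ ≋-refl ︔≋ cast-dropʳ α⇐-IsCast)

  hexagon₂-≋ : σ (X ⊗₀ Y) Z ≋ (id {X} ⊗₁ σ Y Z) ︔ α⇐ ︔ (σ X Z ⊗₁ id {Y})
  hexagon₂-≋ = ≈⇒≋ hexagon₂ ⊙ cast-dropˡ α⇒-IsCast
             ⊙ (≋-refl ︔≋ ≋-refl ︔≋ cast-dropʳ α⇒-IsCast)

  hexagon₂⁻¹-≋ : σ⁻¹ (X ⊗₀ Y) Z ≋ (σ⁻¹ X Z ⊗₁ id {Y}) ︔ α⇒ ︔ (id {X} ⊗₁ σ⁻¹ Y Z)
  hexagon₂⁻¹-≋ = ≋-inverse hexagon₂-≋ σ-isoˡ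
    (︔-assoc ∙ refl⟩︔⟨ (︔-assoc ∙ refl⟩︔⟨ cancelˡ (id⊗-inverse σ-isoʳ)
                        ∙ cancelˡ (cast-inverse α⇒-IsCast α⇐-IsCast))
     ∙ ⊗id-inverse σ-isoʳ)

  idempotent-up-to-cast⇒≋id : {s : X ⇒ Y} {s⁻¹ : Y ⇒ X} (q : Y ≡ X) →
                              s ≋ s ︔ cast q ︔ s → s ︔ s⁻¹ ≈ id → s ≋ id {X}
  idempotent-up-to-cast⇒≋id {s = s} {s⁻¹} q idem inv =
    ≋-sym (cast-dropʳ (cast-IsCast q)) ⊙ ≈⇒≋ (idempotent-invertible⇒id idem′ inv′)
    where
      idem′ : s ︔ cast q ≈ (s ︔ cast q) ︔ (s ︔ cast q)
      idem′ = ≋⇒≈ ((idem ︔≋ ≋-refl) ⊙ assoc-≋ ⊙ (≋-refl ︔≋ assoc-≋) ⊙ sym-assoc-≋)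
      inv′ : (s ︔ cast q) ︔ (cast (sym q) ︔ s⁻¹) ≈ id
      inv′ = ︔-assoc ∙ refl⟩︔⟨ cancelˡ (cast-inverse (cast-IsCast q) (cast-IsCast (sym q))) ∙ inv

  -- The hexagons at I ⊗ I exhibit σ I X and σ X I as idempotents.
  σ-unitˡ-≋ : σ I X ≋ id {X}
  σ-unitˡ-≋ {X} = idempotent-up-to-cast⇒≋id q idem σ-isoˡ ⊙ id≋id ⊗-unitˡ₀
    where
      q = trans ⊗-unitʳ₀ (sym ⊗-unitˡ₀)
      idem : σ I X ≋ σ I X ︔ cast q ︔ σ I X
      idem = σ-≋ (sym ⊗-unitˡ₀) refl ⊙ hexagon₂-≋
           ⊙ (unitˡ-≋ ︔≋ casts-≋ α⇐-IsCast (cast-IsCast q) ⊗-unitˡ₀ ︔≋ unitʳ-≋)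

  σ-unitʳ-≋ : σ X I ≋ id {X}
  σ-unitʳ-≋ {X} = idempotent-up-to-cast⇒≋id q idem σ-isoˡ ⊙ id≋id ⊗-unitʳ₀
    where
      q = trans ⊗-unitˡ₀ (sym ⊗-unitʳ₀)
      idem : σ X I ≋ σ X I ︔ cast q ︔ σ X I
      idem = σ-≋ refl (sym ⊗-unitˡ₀) ⊙ hexagon₁-≋
           ⊙ (unitʳ-≋ ︔≋ casts-≋ α⇒-IsCast (cast-IsCast q) ⊗-unitʳ₀ ︔≋ unitˡ-≋)

  σ⁻¹-unitˡ-≋ : σ⁻¹ I X ≋ id {X}
  σ⁻¹-unitˡ-≋ = ≋-inverse σ-unitˡ-≋ σ-isoˡ ︔-idˡ

  θ-unit : θ I ≈ id
  θ-unit = idempotent-invertible⇒id (≋⇒≈ idem) θ-isoˡ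
    where
      idem : θ I ≋ θ I ︔ θ I
      idem = θ-≋ (sym ⊗-unitˡ₀) ⊙ ≈⇒≋ θ-balance
           ⊙ dropˡ (σ-unitˡ-≋ ⊙ id≋id (sym ⊗-unitʳ₀)) ⊙ dropʳ (σ-unitˡ-≋ ⊙ id≋id (sym ⊗-unitʳ₀))
           ⊙ ≈⇒≋ ⊗≈⊗id︔id⊗ ⊙ (unitʳ-≋ ︔≋ unitˡ-≋)

  snake₁-expansion : (g : X ⇒ Y) → g ≋ λ⇐ ︔ (η X ⊗₁ id) ︔ ((g ⊗₁ id) ⊗₁ id) ︔ α⇒ ︔ (id ⊗₁ ε X) ︔ ρ⇒
  snake₁-expansion {X} g = ≋-sym ((≋-refl ︔≋ ≋-refl ︔≋ slide) ⊙ snake₁-≋)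
    where
      slide : ((g ⊗₁ id {X *}) ⊗₁ id {X}) ︔ α⇒ ︔ (id ⊗₁ ε X) ︔ ρ⇒ ≋ α⇒ ︔ (id ⊗₁ ε X) ︔ ρ⇒ ︔ g
      slide = begin≋
        ((g ⊗₁ id) ⊗₁ id) ︔ α⇒ ︔ (id ⊗₁ ε X) ︔ ρ⇒ ≋⟨ ≈⇒≋ (extendˡ ⊗-assoc₁) ⟩
        α⇒ ︔ (g ⊗₁ (id ⊗₁ id)) ︔ (id ⊗₁ ε X) ︔ ρ⇒ ≋⟨ ≋-refl ︔≋ ((≋-refl ⊗≋ ⊗-id-≋) ︔≋ ≋-refl) ⟩
        α⇒ ︔ (g ⊗₁ id) ︔ (id ⊗₁ ε X) ︔ ρ⇒ ≋⟨ ≋-refl ︔≋ ≈⇒≋ (extendˡ interchange) ⟩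
        α⇒ ︔ (id ⊗₁ ε X) ︔ (g ⊗₁ id) ︔ ρ⇒ ≋⟨ ≋-refl ︔≋ ≋-refl ︔≋ ≈⇒≋ ⊗-unitʳ₁ ⟩
        α⇒ ︔ (id ⊗₁ ε X) ︔ ρ⇒ ︔ g ≋∎
      snake₁-≋ : (λ⇐ ︔ (η X ⊗₁ id) ︔ α⇒ ︔ (id ⊗₁ ε X) ︔ ρ⇒ ︔ g) ≋ g
      snake₁-≋ = (≋-refl ︔≋ ≋-refl ︔≋ ≋-refl ︔≋ sym-assoc-≋) ⊙ (≋-refl ︔≋ ≋-refl ︔≋ sym-assoc-≋)
               ⊙ (≋-refl ︔≋ sym-assoc-≋) ⊙ sym-assoc-≋ ⊙ dropˡ (≈⇒≋ snake₁)

  counits-commute : {p : (X ⊗₀ Y) ⇒ I} {q : (Z ⊗₀ W) ⇒ I} →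
                    (α⇐ ⊗₁ id {W}) ︔ ((p ⊗₁ id {Z}) ⊗₁ id) ︔ (λ⇒ ⊗₁ id) ︔ q
                    ≋ (id {X} ⊗₁ α⇒) ︔ (id ⊗₁ (id {Y} ⊗₁ q)) ︔ (id ⊗₁ ρ⇒) ︔ p
  counits-commute {p = p} {q} = begin≋
    (α⇐ ⊗₁ id) ︔ ((p ⊗₁ id) ⊗₁ id) ︔ (λ⇒ ⊗₁ id) ︔ q ≋⟨ cast-dropˡ (α⇐-IsCast ⊗-IsCast id-IsCast) ⟩
    ((p ⊗₁ id) ⊗₁ id) ︔ (λ⇒ ⊗₁ id) ︔ q
      ≋⟨ ⊗-assoc-≋ ︔≋ (casts-≋ (λ⇒-IsCast ⊗-IsCast id-IsCast) λ⇒-IsCast ⊗-assoc₀ ︔≋ ≋-refl) ⟩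
    (p ⊗₁ (id ⊗₁ id)) ︔ λ⇒ ︔ q ≋⟨ (≋-refl ⊗≋ ⊗-id-≋) ︔≋ ≈⇒≋ (≈-sym ⊗-unitˡ₁) ⟩
    (p ⊗₁ id) ︔ (id ⊗₁ q) ︔ λ⇒ ≋⟨ sym-assoc-≋ ⊙ (≈⇒≋ (≈-sym ⊗≈⊗id︔id⊗) ︔≋ casts-≋ λ⇒-IsCast ρ⇒-IsCast refl) ⟩
    (p ⊗₁ q) ︔ ρ⇒ ≋⟨ (≈⇒≋ ⊗≈id⊗︔⊗id ︔≋ ≋-refl) ⊙ assoc-≋ ⟩
    (id ⊗₁ q) ︔ (p ⊗₁ id) ︔ ρ⇒ ≋⟨ (≋-sym ⊗-id-≋ ⊗≋ ≋-refl) ︔≋ ≈⇒≋ ⊗-unitʳ₁ ⟩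
    ((id ⊗₁ id) ⊗₁ q) ︔ ρ⇒ ︔ p
      ≋⟨ ⊗-assoc-≋ ︔≋ (casts-≋ ρ⇒-IsCast (id-IsCast ⊗-IsCast ρ⇒-IsCast) ⊗-assoc₀ ︔≋ ≋-refl) ⟩
    (id ⊗₁ (id ⊗₁ q)) ︔ (id ⊗₁ ρ⇒) ︔ p ≋⟨ ≋-sym (cast-dropˡ (id-IsCast ⊗-IsCast α⇒-IsCast)) ⟩
    (id ⊗₁ α⇒) ︔ (id ⊗₁ (id ⊗₁ q)) ︔ (id ⊗₁ ρ⇒) ︔ p ≋∎

  ε-dinatural : (g : X ⇒ Y) → (dual g ⊗₁ id {X}) ︔ ε X ≈ (id {Y *} ⊗₁ g) ︔ ε Y
  ε-dinatural {X} {Y} g = ≋⇒≈ (lhs ⊙ ≋-sym rhs)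
    where
      top = (id {Y *} ⊗₁ (η X ⊗₁ id {X})) ︔ (id ⊗₁ ((g ⊗₁ id {X *}) ⊗₁ id {X}))
      bottom = (id {Y *} ⊗₁ α⇒) ︔ (id ⊗₁ (id ⊗₁ ε X)) ︔ (id ⊗₁ ρ⇒) ︔ ε Y
      lhs : (dual g ⊗₁ id {X}) ︔ ε X ≋ top ︔ bottom
      lhs = begin≋
        (dual g ⊗₁ id {X}) ︔ ε X
          ≋⟨ (︔-⊗id-≋ ⊙ (≋-refl ︔≋ (︔-⊗id-≋ ⊙ (≋-refl ︔≋ (︔-⊗id-≋ ⊙ (≋-refl ︔≋
              (︔-⊗id-≋ ⊙ (≋-refl ︔≋ ︔-⊗id-≋)))))))) ︔≋ ≋-refl ⟩
        ((ρ⇐ ⊗₁ id) ︔ ((id ⊗₁ η X) ⊗₁ id) ︔ ((id ⊗₁ (g ⊗₁ id)) ⊗₁ id) ︔ (α⇐ ⊗₁ id)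
          ︔ ((ε Y ⊗₁ id) ⊗₁ id) ︔ (λ⇒ ⊗₁ id)) ︔ ε X
          ≋⟨ assoc-≋ ⊙ (≋-refl ︔≋ (assoc-≋ ⊙ (≋-refl ︔≋ (assoc-≋ ⊙ (≋-refl ︔≋
              (assoc-≋ ⊙ (≋-refl ︔≋ assoc-≋))))))) ⟩
        (ρ⇐ ⊗₁ id) ︔ ((id ⊗₁ η X) ⊗₁ id) ︔ ((id ⊗₁ (g ⊗₁ id)) ⊗₁ id)
          ︔ (α⇐ ⊗₁ id) ︔ ((ε Y ⊗₁ id) ⊗₁ id) ︔ (λ⇒ ⊗₁ id) ︔ ε X
          ≋⟨ cast-dropˡ (ρ⇐-IsCast ⊗-IsCast id-IsCast) ⊙ sym-assoc-≋ ⟩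
        (((id ⊗₁ η X) ⊗₁ id) ︔ ((id ⊗₁ (g ⊗₁ id)) ⊗₁ id))
          ︔ (α⇐ ⊗₁ id) ︔ ((ε Y ⊗₁ id) ⊗₁ id) ︔ (λ⇒ ⊗₁ id) ︔ ε X
          ≋⟨ (⊗-assoc-≋ ︔≋ ⊗-assoc-≋) ︔≋ counits-commute ⟩
        top ︔ bottom ≋∎
      rhs : (id {Y *} ⊗₁ g) ︔ ε Y ≋ top ︔ bottom
      rhs = begin≋
        (id ⊗₁ g) ︔ ε Y ≋⟨ (≋-refl ⊗≋ snake₁-expansion g) ︔≋ ≋-refl ⟩
        (id ⊗₁ (λ⇐ ︔ (η X ⊗₁ id) ︔ ((g ⊗₁ id) ⊗₁ id) ︔ α⇒ ︔ (id ⊗₁ ε X) ︔ ρ⇒)) ︔ ε Y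
          ≋⟨ (id⊗-︔-≋ ⊙ (≋-refl ︔≋ (id⊗-︔-≋ ⊙ (≋-refl ︔≋ (id⊗-︔-≋ ⊙ (≋-refl ︔≋
              (id⊗-︔-≋ ⊙ (≋-refl ︔≋ id⊗-︔-≋)))))))) ︔≋ ≋-refl ⟩
        ((id ⊗₁ λ⇐) ︔ (id ⊗₁ (η X ⊗₁ id)) ︔ (id ⊗₁ ((g ⊗₁ id) ⊗₁ id)) ︔ (id ⊗₁ α⇒)
          ︔ (id ⊗₁ (id ⊗₁ ε X)) ︔ (id ⊗₁ ρ⇒)) ︔ ε Y
          ≋⟨ assoc-≋ ⊙ (≋-refl ︔≋ (assoc-≋ ⊙ (≋-refl ︔≋ (assoc-≋ ⊙ (≋-refl ︔≋
              (assoc-≋ ⊙ (≋-refl ︔≋ assoc-≋))))))) ⟩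
        (id ⊗₁ λ⇐) ︔ (id ⊗₁ (η X ⊗₁ id)) ︔ (id ⊗₁ ((g ⊗₁ id) ⊗₁ id)) ︔ bottom
          ≋⟨ cast-dropˡ (id-IsCast ⊗-IsCast λ⇐-IsCast) ⊙ sym-assoc-≋ ⟩
        top ︔ bottom ≋∎

  θ-ε-dinatural : (θ (X *) ⊗₁ id) ︔ ε X ≈ (id ⊗₁ θ X) ︔ ε X
  θ-ε-dinatural {X} = ≈-sym θ-dual ⟩⊗⟨refl ⟩︔⟨refl ∙ ε-dinatural (θ X)

  θ⁻¹-ε-dinatural : (θ⁻¹ (X *) ⊗₁ id) ︔ ε X ≈ (id ⊗₁ θ⁻¹ X) ︔ ε X
  θ⁻¹-ε-dinatural {X} =
    refl⟩︔⟨ (≈-sym ︔-idˡ ∙ ≈-sym (≈-sym id⊗-︔ ∙ refl⟩⊗⟨ θ-isoʳ ∙ ⊗-id) ⟩︔⟨refl ∙ ︔-assoc)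
    ∙ refl⟩︔⟨ refl⟩︔⟨ ≈-sym θ-ε-dinatural
    ∙ sym-assoc ∙ interchange ⟩︔⟨refl ∙ ︔-assoc
    ∙ refl⟩︔⟨ (pullˡ (≈-sym ︔-⊗id ∙ θ-isoʳ ⟩⊗⟨refl ∙ ⊗-id) ∙ ︔-idˡ)

  -- θ (X * ⊗ X) is absorbed by ε X (naturality of θ and θ I = id); balancing expands it.
  ε-absorbs-monodromy : σ (X *) X ︔ σ X (X *) ︔ (id ⊗₁ (θ X ︔ θ X)) ︔ ε X ≈ ε X
  ε-absorbs-monodromy {X} = ≈-sym
    (≈-sym ︔-idʳ ∙ refl⟩︔⟨ ≈-sym θ-unit ∙ θ-natural ∙ θ-balance ⟩︔⟨refl
     ∙ ︔-assoc ∙ refl⟩︔⟨ (︔-assoc ∙ pullˡ σ-natural ∙ ︔-assoc)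
     ∙ refl⟩︔⟨ refl⟩︔⟨ (⊗≈id⊗︔⊗id ⟩︔⟨refl ∙ ︔-assoc ∙ refl⟩︔⟨ θ-ε-dinatural
                        ∙ sym-assoc ∙ ≈-sym id⊗-︔ ⟩︔⟨refl))

  σ⁻¹-ε : σ⁻¹ (X *) X ︔ ε X ≈ σ X (X *) ︔ (id ⊗₁ (θ X ︔ θ X)) ︔ ε X
  σ⁻¹-ε = refl⟩︔⟨ ≈-sym ε-absorbs-monodromy ∙ cancelˡ σ-isoʳ

  η′ : ∀ X → I ⇒ ((X *) ⊗₀ X)
  η′ X = η X ︔ (id ⊗₁ θ⁻¹ (X *)) ︔ σ⁻¹ (X *) X

  curl-crossing-change :
    (η′ X ⊗₁ id {X}) ︔ α⇒ ︔ (id ⊗₁ σ X X) ︔ α⇐ ︔ (ε X ⊗₁ id {X})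
    ≋ (η′ X ⊗₁ id) ︔ α⇒ ︔ (id ⊗₁ σ⁻¹ X X) ︔ α⇐ ︔ ((id ⊗₁ (θ X ︔ θ X)) ⊗₁ id) ︔ (ε X ⊗₁ id)
  curl-crossing-change {X} = begin≋
    (η′ X ⊗₁ id) ︔ α⇒ ︔ (id ⊗₁ σ X X) ︔ α⇐ ︔ (ε X ⊗₁ id)
      ≋⟨ ≋-refl ︔≋ hexagon₂-step ⟩
    (η′ X ⊗₁ id) ︔ σ ((X *) ⊗₀ X) X ︔ α⇐ ︔ (s⁻ ⊗₁ id) ︔ (ε X ⊗₁ id)
      ≋⟨ sym-assoc-≋ ⊙ (≈⇒≋ σ-natural ︔≋ ≋-refl) ⊙ assoc-≋ ⊙ dropˡ (σ-unitˡ-≋ ⊙ id≋id (sym ⊗-unitʳ₀)) ⟩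
    (id ⊗₁ η′ X) ︔ α⇐ ︔ (s⁻ ⊗₁ id) ︔ (ε X ⊗₁ id)
      ≋⟨ ≋-refl ︔≋ ≋-refl ︔≋ (≈⇒≋ (≈-sym ︔-⊗id) ⊙ (≈⇒≋ σ⁻¹-ε ⊗≋ ≋-refl) ⊙ ︔-⊗id-≋ ⊙ (≋-refl ︔≋ ︔-⊗id-≋)) ⟩
    (id ⊗₁ η′ X) ︔ α⇐ ︔ (σ X (X *) ⊗₁ id) ︔ ((id ⊗₁ θθ) ⊗₁ id) ︔ (ε X ⊗₁ id)
      ≋⟨ ≋-refl ︔≋ hexagon₁-step ⟩
    (id ⊗₁ η′ X) ︔ σ X ((X *) ⊗₀ X) ︔ α⇒ ︔ (id ⊗₁ σ⁻¹ X X) ︔ α⇐ ︔ ((id ⊗₁ θθ) ⊗₁ id) ︔ (ε X ⊗₁ id)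
      ≋⟨ sym-assoc-≋ ⊙ (≈⇒≋ σ-natural ︔≋ ≋-refl) ⊙ assoc-≋ ⊙ dropˡ (σ-unitʳ-≋ ⊙ id≋id (sym ⊗-unitˡ₀)) ⟩
    (η′ X ⊗₁ id) ︔ α⇒ ︔ (id ⊗₁ σ⁻¹ X X) ︔ α⇐ ︔ ((id ⊗₁ θθ) ⊗₁ id) ︔ (ε X ⊗₁ id) ≋∎
    where
      s⁻ = σ⁻¹ (X *) X
      θθ = θ X ︔ θ X
      hexagon₂-step : α⇒ ︔ (id ⊗₁ σ X X) ︔ α⇐ ︔ (ε X ⊗₁ id {X})
                    ≋ σ ((X *) ⊗₀ X) X ︔ α⇐ ︔ (s⁻ ⊗₁ id) ︔ (ε X ⊗₁ id)
      hexagon₂-step = begin≋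
        α⇒ ︔ (id ⊗₁ σ X X) ︔ α⇐ ︔ (ε X ⊗₁ id) ≋⟨ cast-dropˡ α⇒-IsCast ⟩
        (id ⊗₁ σ X X) ︔ α⇐ ︔ (ε X ⊗₁ id)
          ≋⟨ ≋-refl ︔≋ ≋-refl ︔≋ ≋-sym (dropˡ (≈⇒≋ (⊗id-inverse σ-isoˡ))) ⟩
        (id ⊗₁ σ X X) ︔ α⇐ ︔ ((σ (X *) X ⊗₁ id) ︔ (s⁻ ⊗₁ id)) ︔ (ε X ⊗₁ id)
          ≋⟨ (≋-refl ︔≋ ≋-refl ︔≋ assoc-≋) ⊙ (≋-refl ︔≋ sym-assoc-≋) ⊙ sym-assoc-≋ ⟩
        ((id ⊗₁ σ X X) ︔ α⇐ ︔ (σ (X *) X ⊗₁ id)) ︔ (s⁻ ⊗₁ id) ︔ (ε X ⊗₁ id)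
          ≋⟨ ≋-sym hexagon₂-≋ ︔≋ ≋-sym (cast-dropˡ α⇐-IsCast) ⟩
        σ ((X *) ⊗₀ X) X ︔ α⇐ ︔ (s⁻ ⊗₁ id) ︔ (ε X ⊗₁ id) ≋∎
      hexagon₁-step : α⇐ ︔ (σ X (X *) ⊗₁ id) ︔ ((id ⊗₁ θθ) ⊗₁ id) ︔ (ε X ⊗₁ id {X})
                    ≋ σ X ((X *) ⊗₀ X) ︔ α⇒ ︔ (id ⊗₁ σ⁻¹ X X) ︔ α⇐ ︔ ((id ⊗₁ θθ) ⊗₁ id) ︔ (ε X ⊗₁ id)
      hexagon₁-step = begin≋
        α⇐ ︔ (σ X (X *) ⊗₁ id) ︔ ((id ⊗₁ θθ) ⊗₁ id) ︔ (ε X ⊗₁ id) ≋⟨ cast-dropˡ α⇐-IsCast ⟩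
        (σ X (X *) ⊗₁ id) ︔ ((id ⊗₁ θθ) ⊗₁ id) ︔ (ε X ⊗₁ id)
          ≋⟨ ≋-sym (assoc-≋ ⊙ (≋-refl ︔≋ (assoc-≋ ⊙ (≋-refl ︔≋ (sym-assoc-≋ ⊙ dropˡ (≈⇒≋ (id⊗-inverse σ-isoˡ))))
                                          ⊙ ≈⇒≋ (cancelˡ (cast-inverse α⇒-IsCast α⇐-IsCast))))) ⟩
        ((σ X (X *) ⊗₁ id) ︔ α⇒ ︔ (id ⊗₁ σ X X)) ︔ (id ⊗₁ σ⁻¹ X X) ︔ α⇐ ︔ ((id ⊗₁ θθ) ⊗₁ id) ︔ (ε X ⊗₁ id)
          ≋⟨ ≋-sym hexagon₁-≋ ︔≋ ≋-sym (cast-dropˡ α⇒-IsCast) ⟩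
        σ X ((X *) ⊗₀ X) ︔ α⇒ ︔ (id ⊗₁ σ⁻¹ X X) ︔ α⇐ ︔ ((id ⊗₁ θθ) ⊗₁ id) ︔ (ε X ⊗₁ id) ≋∎

  inverse-curl≋θ :
    (η′ X ⊗₁ id) ︔ α⇒ ︔ (id ⊗₁ σ⁻¹ X X) ︔ α⇐ ︔ ((id ⊗₁ (θ X ︔ θ X)) ⊗₁ id) ︔ (ε X ⊗₁ id {X}) ≋ θ X
  inverse-curl≋θ {X} = begin≋
    (η′ X ⊗₁ id) ︔ α⇒ ︔ (id ⊗₁ σ⁻¹ X X) ︔ α⇐ ︔ ((id ⊗₁ θθ) ⊗₁ id) ︔ (ε X ⊗₁ id)
      ≋⟨ ((︔-⊗id-≋ ⊙ (≋-refl ︔≋ ︔-⊗id-≋)) ︔≋ ≋-refl) ⊙ assoc-≋ ⊙ (≋-refl ︔≋ assoc-≋)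
         ⊙ (≋-refl ︔≋ ≋-refl ︔≋ hexagon₂⁻¹-step) ⟩
    (η X ⊗₁ id) ︔ ((id ⊗₁ θ⁻¹ (X *)) ⊗₁ id) ︔ α⇒ ︔ σ⁻¹ ((X *) ⊗₀ X) X ︔ ((id ⊗₁ θθ) ⊗₁ id) ︔ (ε X ⊗₁ id)
      ≋⟨ ≋-refl ︔≋ ≋-refl ︔≋ ≋-refl ︔≋ ((≋-refl ︔≋ ≋-sym ︔-⊗id-≋) ⊙ ≈⇒≋ (≈-sym σ⁻¹-natural)
                                       ⊙ dropʳ (σ⁻¹-unitˡ-≋ ⊙ id≋id (sym ⊗-unitʳ₀))) ⟩
    (η X ⊗₁ id) ︔ ((id ⊗₁ θ⁻¹ (X *)) ⊗₁ id) ︔ α⇒ ︔ (id ⊗₁ ((id ⊗₁ θθ) ︔ ε X))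
      ≋⟨ ≋-refl ︔≋ ≈⇒≋ (extendˡ ⊗-assoc₁ ∙ refl⟩︔⟨ (≈-sym id⊗-︔ ∙ refl⟩⊗⟨ θ⁻¹-cancels)) ⟩
    (η X ⊗₁ id) ︔ α⇒ ︔ (id ⊗₁ ((id ⊗₁ θ X) ︔ ε X))
      ≋⟨ ≋-refl ︔≋ ≋-refl ︔≋ id⊗-︔-≋ ⟩
    (η X ⊗₁ id) ︔ α⇒ ︔ (id ⊗₁ (id ⊗₁ θ X)) ︔ (id ⊗₁ ε X)
      ≋⟨ ≋-refl ︔≋ ≈⇒≋ (pullˡ (≈-sym ⊗-assoc₁) ∙ ︔-assoc) ⟩
    (η X ⊗₁ id) ︔ ((id ⊗₁ id) ⊗₁ θ X) ︔ α⇒ ︔ (id ⊗₁ ε X)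
      ≋⟨ ≋-refl ︔≋ ((⊗-id-≋ ⊗≋ ≋-refl) ︔≋ ≋-refl) ⟩
    (η X ⊗₁ id) ︔ (id ⊗₁ θ X) ︔ α⇒ ︔ (id ⊗₁ ε X)
      ≋⟨ ≈⇒≋ (pullˡ interchange ∙ ︔-assoc) ⟩
    (id ⊗₁ θ X) ︔ (η X ⊗₁ id) ︔ α⇒ ︔ (id ⊗₁ ε X)
      ≋⟨ unitˡ-≋ ︔≋ ≋-sym (cast-dropˡ λ⇐-IsCast ⊙ (≋-refl ︔≋ ≋-refl ︔≋ cast-dropʳ ρ⇒-IsCast)) ⟩
    θ X ︔ λ⇐ ︔ (η X ⊗₁ id) ︔ α⇒ ︔ (id ⊗₁ ε X) ︔ ρ⇒
      ≋⟨ (≋-refl ︔≋ ≈⇒≋ snake₁) ⊙ ≈⇒≋ ︔-idʳ ⟩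
    θ X ≋∎
    where
      s⁻ = σ⁻¹ (X *) X
      θθ = θ X ︔ θ X
      hexagon₂⁻¹-step : (s⁻ ⊗₁ id {X}) ︔ α⇒ ︔ (id ⊗₁ σ⁻¹ X X) ︔ α⇐ ︔ ((id ⊗₁ θθ) ⊗₁ id) ︔ (ε X ⊗₁ id)
                      ≋ α⇒ ︔ σ⁻¹ ((X *) ⊗₀ X) X ︔ ((id ⊗₁ θθ) ⊗₁ id) ︔ (ε X ⊗₁ id)
      hexagon₂⁻¹-step =
        (≋-refl ︔≋ ≋-refl ︔≋ sym-assoc-≋) ⊙ (≋-refl ︔≋ sym-assoc-≋) ⊙ sym-assoc-≋
        ⊙ (((≋-refl ︔≋ ≋-refl ︔≋ cast-dropʳ α⇐-IsCast) ⊙ ≋-sym hexagon₂⁻¹-≋ ⊙ ≋-sym (cast-dropˡ α⇒-IsCast)) ︔≋ ≋-refl)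
        ⊙ assoc-≋
      θ⁻¹-cancels : (θ⁻¹ (X *) ⊗₁ id) ︔ (id ⊗₁ θθ) ︔ ε X ≈ (id ⊗₁ θ X) ︔ ε X
      θ⁻¹-cancels = sym-assoc ∙ interchange ⟩︔⟨refl ∙ ︔-assoc ∙ refl⟩︔⟨ θ⁻¹-ε-dinatural
                  ∙ sym-assoc ∙ (≈-sym id⊗-︔ ∙ refl⟩⊗⟨ (︔-assoc ∙ refl⟩︔⟨ θ-isoˡ ∙ ︔-idʳ)) ⟩︔⟨refl

  curl≋θ : (η′ X ⊗₁ id {X}) ︔ α⇒ ︔ (id ⊗₁ σ X X) ︔ α⇐ ︔ (ε X ⊗₁ id {X}) ≋ θ X
  curl≋θ = curl-crossing-change ⊙ inverse-curl≋θ

  counit-slide : {h : (X ⊗₀ Y) ⇒ Z} (q : W ⇒ I) →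
                 (id {X} ⊗₁ (id {Y} ⊗₁ q)) ︔ (id ⊗₁ ρ⇒) ︔ h ≋ α⇐ ︔ (h ⊗₁ id {W}) ︔ (id {Z} ⊗₁ q) ︔ ρ⇒
  counit-slide {h = h} q =
    (⊗-sym-assoc-≋ ︔≋ casts-≋ (id-IsCast ⊗-IsCast ρ⇒-IsCast) ρ⇒-IsCast (sym ⊗-assoc₀) ︔≋ ≋-refl)
    ⊙ ≈⇒≋ (refl⟩︔⟨ ≈-sym ⊗-unitʳ₁ ∙ sym-assoc ∙ (⊗-id ⟩⊗⟨refl ⟩︔⟨refl ∙ ≈-sym interchange) ⟩︔⟨refl ∙ ︔-assoc)
    ⊙ ≋-sym (cast-dropˡ α⇐-IsCast)

  counit⊗id≈σ : (q : Z ⇒ I) → q ⊗₁ id {Y} ≈ σ Z Y ︔ (id ⊗₁ q) ︔ cast (trans ⊗-unitʳ₀ (sym ⊗-unitˡ₀))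
  counit⊗id≈σ q =
    ≈-sym ︔-idʳ ∙ refl⟩︔⟨ ≈-sym (cast-inverse (≋id⇒IsCast σ-unitˡ-≋) (cast-IsCast _))
    ∙ sym-assoc ∙ σ-natural ⟩︔⟨refl ∙ ︔-assoc

  postpone-counit : (u : W ⇒ (X ⊗₀ Z)) (q : Z ⇒ I) {h : (X ⊗₀ Y) ⇒ Z′} →
                    ((u ︔ (id ⊗₁ q) ︔ ρ⇒) ⊗₁ id {Y}) ︔ h
                    ≋ (u ⊗₁ id) ︔ α⇒ ︔ (id ⊗₁ σ Z Y) ︔ α⇐ ︔ (h ⊗₁ id) ︔ (id ⊗₁ q)
  postpone-counit {Z = Z} {Y = Y} u q {h} =
    ((︔-⊗id-≋ ⊙ (≋-refl ︔≋ ︔-⊗id-≋)) ︔≋ ≋-refl) ⊙ assoc-≋ ⊙ (≋-refl ︔≋ assoc-≋)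
    ⊙ (≋-refl ︔≋ (slide ⊙ (≋-refl ︔≋ ≋-refl ︔≋ ≋-refl ︔≋ ≋-refl ︔≋ cast-dropʳ ρ⇒-IsCast)))
    where
      merge-casts = casts-≋ ((id-IsCast ⊗-IsCast cast-IsCast _) ︔-IsCast (id-IsCast ⊗-IsCast λ⇒-IsCast))
                            (id-IsCast ⊗-IsCast ρ⇒-IsCast) refl
      slide : ((id ⊗₁ q) ⊗₁ id {Y}) ︔ (ρ⇒ ⊗₁ id) ︔ h ≋ α⇒ ︔ (id ⊗₁ σ Z Y) ︔ α⇐ ︔ (h ⊗₁ id) ︔ (id ⊗₁ q) ︔ ρ⇒
      slide = begin≋
        ((id ⊗₁ q) ⊗₁ id) ︔ (ρ⇒ ⊗₁ id) ︔ h
          ≋⟨ ⊗-assoc-≋ ︔≋ (casts-≋ (ρ⇒-IsCast ⊗-IsCast id-IsCast) (id-IsCast ⊗-IsCast λ⇒-IsCast) ⊗-assoc₀ ︔≋ ≋-refl) ⟩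
        (id ⊗₁ (q ⊗₁ id)) ︔ (id ⊗₁ λ⇒) ︔ h ≋⟨ (≋-refl ⊗≋ ≈⇒≋ (counit⊗id≈σ q)) ︔≋ ≋-refl ⟩
        (id ⊗₁ (σ Z Y ︔ (id ⊗₁ q) ︔ cast _)) ︔ (id ⊗₁ λ⇒) ︔ h
          ≋⟨ ((id⊗-︔-≋ ⊙ (≋-refl ︔≋ id⊗-︔-≋)) ︔≋ ≋-refl) ⊙ assoc-≋ ⊙ (≋-refl ︔≋ assoc-≋)
             ⊙ (≋-refl ︔≋ ≋-refl ︔≋ (sym-assoc-≋ ⊙ (merge-casts ︔≋ ≋-refl))) ⟩
        (id ⊗₁ σ Z Y) ︔ (id ⊗₁ (id ⊗₁ q)) ︔ (id ⊗₁ ρ⇒) ︔ h ≋⟨ ≋-refl ︔≋ counit-slide q ⟩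
        (id ⊗₁ σ Z Y) ︔ α⇐ ︔ (h ⊗₁ id) ︔ (id ⊗₁ q) ︔ ρ⇒ ≋⟨ ≋-sym (cast-dropˡ α⇒-IsCast) ⟩
        α⇒ ︔ (id ⊗₁ σ Z Y) ︔ α⇐ ︔ (h ⊗₁ id) ︔ (id ⊗₁ q) ︔ ρ⇒ ≋∎

  η-transpose : ((X *) ⊗₀ Y) ⇒ I → Y ⇒ X
  η-transpose {X} q = λ⇐ ︔ (η X ⊗₁ id) ︔ α⇒ ︔ (id {X} ⊗₁ q) ︔ ρ⇒

  ε-transpose : Y ⇒ X → ((X *) ⊗₀ Y) ⇒ I
  ε-transpose {X = X} u = (id {X *} ⊗₁ u) ︔ ε X

  η-transpose-ε-transpose : (u : Y ⇒ X) → η-transpose (ε-transpose u) ≈ u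
  η-transpose-ε-transpose u =
    refl⟩︔⟨ refl⟩︔⟨ refl⟩︔⟨ (id⊗-︔ ⟩︔⟨refl ∙ ︔-assoc)
    ∙ refl⟩︔⟨ refl⟩︔⟨ (pullˡ (≈-sym ⊗-assoc₁) ∙ ︔-assoc)
    ∙ refl⟩︔⟨ (refl⟩︔⟨ (⊗-id ⟩⊗⟨refl ⟩︔⟨refl) ∙ extendˡ interchange)
    ∙ pullˡ λ⇐-natural ∙ ︔-assoc ∙ refl⟩︔⟨ snake₁ ∙ ︔-idʳ

  ε-transpose-η-transpose : (q : ((X *) ⊗₀ Y) ⇒ I) → ε-transpose (η-transpose q) ≈ q
  ε-transpose-η-transpose {X} {Y} q = ≋⇒≈ (begin≋
    (id ⊗₁ (λ⇐ ︔ (η X ⊗₁ id) ︔ α⇒ ︔ (id ⊗₁ q) ︔ ρ⇒)) ︔ ε X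
      ≋⟨ ((id⊗-︔-≋ ⊙ (≋-refl ︔≋ (id⊗-︔-≋ ⊙ (≋-refl ︔≋ (id⊗-︔-≋ ⊙ (≋-refl ︔≋ id⊗-︔-≋)))))) ︔≋ ≋-refl)
         ⊙ assoc-≋ ⊙ (≋-refl ︔≋ assoc-≋) ⊙ (≋-refl ︔≋ ≋-refl ︔≋ assoc-≋) ⊙ (≋-refl ︔≋ ≋-refl ︔≋ ≋-refl ︔≋ assoc-≋) ⟩
    (id ⊗₁ λ⇐) ︔ (id ⊗₁ (η X ⊗₁ id)) ︔ (id ⊗₁ α⇒) ︔ (id ⊗₁ (id ⊗₁ q)) ︔ (id ⊗₁ ρ⇒) ︔ ε X
      ≋⟨ ≋-refl ︔≋ ≋-refl ︔≋ ≋-refl ︔≋ (counit-slide q ⊙ (≋-refl ︔≋ ≋-refl ︔≋ unit-counit)) ⟩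
    (id ⊗₁ λ⇐) ︔ (id ⊗₁ (η X ⊗₁ id)) ︔ (id ⊗₁ α⇒) ︔ α⇐ ︔ (ε X ⊗₁ id) ︔ λ⇒ ︔ q
      ≋⟨ ≋-refl ︔≋ ≋-refl ︔≋ sym-assoc-≋ ⟩
    (id ⊗₁ λ⇐) ︔ (id ⊗₁ (η X ⊗₁ id)) ︔ ((id ⊗₁ α⇒) ︔ α⇐) ︔ (ε X ⊗₁ id) ︔ λ⇒ ︔ q
      ≋⟨ casts-≋ (id-IsCast ⊗-IsCast λ⇐-IsCast) (ρ⇐-IsCast ⊗-IsCast id-IsCast) refl
         ︔≋ ⊗-sym-assoc-≋
         ︔≋ casts-≋ ((id-IsCast ⊗-IsCast α⇒-IsCast) ︔-IsCast α⇐-IsCast) (α⇐-IsCast ⊗-IsCast id-IsCast) (sym ⊗-assoc₀)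
         ︔≋ ((≋-refl ⊗≋ ≋-sym ⊗-id-≋) ⊙ ⊗-sym-assoc-≋)
         ︔≋ casts-≋ λ⇒-IsCast (λ⇒-IsCast ⊗-IsCast id-IsCast) (sym ⊗-assoc₀)
         ︔≋ ≋-refl ⟩
    (ρ⇐ ⊗₁ id) ︔ ((id ⊗₁ η X) ⊗₁ id) ︔ (α⇐ ⊗₁ id) ︔ ((ε X ⊗₁ id) ⊗₁ id) ︔ (λ⇒ ⊗₁ id) ︔ q
      ≋⟨ (≋-refl ︔≋ ≋-refl ︔≋ ≋-refl ︔≋ sym-assoc-≋) ⊙ (≋-refl ︔≋ ≋-refl ︔≋ sym-assoc-≋)
         ⊙ (≋-refl ︔≋ sym-assoc-≋) ⊙ sym-assoc-≋
         ⊙ (≋-sym (︔-⊗id-≋ ⊙ (≋-refl ︔≋ (︔-⊗id-≋ ⊙ (≋-refl ︔≋ (︔-⊗id-≋ ⊙ (≋-refl ︔≋ ︔-⊗id-≋)))))) ︔≋ ≋-refl) ⟩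
    ((ρ⇐ ︔ (id ⊗₁ η X) ︔ α⇐ ︔ (ε X ⊗₁ id) ︔ λ⇒) ⊗₁ id {Y}) ︔ q
      ≋⟨ dropˡ ((≈⇒≋ snake₂ ⊗≋ ≋-refl) ⊙ ⊗-id-≋) ⟩
    q ≋∎)
    where
      unit-counit : (id {I} ⊗₁ q) ︔ ρ⇒ ≋ λ⇒ ︔ q
      unit-counit = (≋-refl ︔≋ casts-≋ ρ⇒-IsCast λ⇒-IsCast refl) ⊙ ≈⇒≋ ⊗-unitˡ₁

  η-transpose-injective : {q q′ : ((X *) ⊗₀ Y) ⇒ I} → η-transpose q ≈ η-transpose q′ → q ≈ q′
  η-transpose-injective {q = q} {q′} p =
    ≈-sym (ε-transpose-η-transpose q) ∙ (refl⟩⊗⟨ p) ⟩︔⟨refl ∙ ε-transpose-η-transpose q′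

  ε-transpose-injective : {u u′ : Y ⇒ X} → ε-transpose u ≈ ε-transpose u′ → u ≈ u′
  ε-transpose-injective {u = u} {u′} p =
    ≈-sym (η-transpose-ε-transpose u) ∙ refl⟩︔⟨ refl⟩︔⟨ refl⟩︔⟨ ((refl⟩⊗⟨ p) ⟩︔⟨refl)
    ∙ η-transpose-ε-transpose u′

  id⊗id⊗≋conjugate : (Q : Z ⇒ W) →
                     (id {X} ⊗₁ (id {Y} ⊗₁ Q))
                     ≋ (σ X Y ⊗₁ id) ︔ α⇒ ︔ (id {Y} ⊗₁ (id {X} ⊗₁ Q)) ︔ α⇐ ︔ (σ⁻¹ X Y ⊗₁ id)
  id⊗id⊗≋conjugate Q =
    (⊗-sym-assoc-≋ ⊙ (⊗-id-≋ ⊗≋ ≋-refl)) ⊙ ≈⇒≋ (≈-sym unbraid)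
    ⊙ (≋-refl ︔≋ ((((≋-sym ⊗-id-≋ ⊗≋ ≋-refl) ⊙ ⊗-assoc-≋ ⊙ ≋-sym (cast-dropˡ α⇒-IsCast))
                   ︔≋ ≋-sym (cast-dropˡ α⇐-IsCast)) ⊙ assoc-≋))
    where
      unbraid = pullˡ interchange ∙ ︔-assoc ∙ refl⟩︔⟨ ⊗id-inverse σ-isoˡ ∙ ︔-idʳ

  id⊗≈⇒id⊗id⊗≈ : {Q Q′ : Z ⇒ W} → id {X} ⊗₁ Q ≈ id ⊗₁ Q′ → id {X} ⊗₁ (id {Y} ⊗₁ Q) ≈ id ⊗₁ (id ⊗₁ Q′)
  id⊗≈⇒id⊗id⊗≈ {Q = Q} {Q′} p =
    ≋⇒≈ (id⊗id⊗≋conjugate Q ⊙ (≋-refl ︔≋ ≋-refl ︔≋ ≈⇒≋ (refl⟩⊗⟨ p) ︔≋ ≋-refl) ⊙ ≋-sym (id⊗id⊗≋conjugate Q′))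

  id⊗-ε-transpose-injective : {u u′ : Y ⇒ X} →
                              id {Z} ⊗₁ ε-transpose u ≈ id ⊗₁ ε-transpose u′ → id {Z} ⊗₁ u ≈ id ⊗₁ u′
  id⊗-ε-transpose-injective {u = u} {u′} p = ≋⇒≈ (
    ≈⇒≋ (refl⟩⊗⟨ ≈-sym (η-transpose-ε-transpose u)) ⊙ distribute
    ⊙ (≋-refl ︔≋ ≋-refl ︔≋ ≋-refl ︔≋ (≈⇒≋ (id⊗≈⇒id⊗id⊗≈ p) ︔≋ ≋-refl))
    ⊙ ≋-sym distribute ⊙ ≈⇒≋ (refl⟩⊗⟨ η-transpose-ε-transpose u′))
    where
      distribute : ∀ {V₀ V₁ V₂ V₃ V₄ V₅}
                   {a : V₀ ⇒ V₁} {b : V₁ ⇒ V₂} {c : V₂ ⇒ V₃} {d : V₃ ⇒ V₄} {e : V₄ ⇒ V₅} →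
                   (id {Z} ⊗₁ (a ︔ b ︔ c ︔ d ︔ e))
                   ≋ (id ⊗₁ a) ︔ (id ⊗₁ b) ︔ (id ⊗₁ c) ︔ (id ⊗₁ d) ︔ (id ⊗₁ e)
      distribute = id⊗-︔-≋ ⊙ (≋-refl ︔≋ (id⊗-︔-≋ ⊙ (≋-refl ︔≋ (id⊗-︔-≋ ⊙ (≋-refl ︔≋ id⊗-︔-≋)))))

module ReflexiveLemmas {o ℓ e} (𝒞 : StrictRibbonCategory o ℓ e) (R : ReflexiveObject 𝒞) where
  open RibbonLemmas 𝒞 public
  open ReflexiveObject R public
  open Reflexive 𝒞 R public

  private
    variable
      X Y : Obj

  lam-≋ : lam ≋ (id {A} ⊗₁ η′ A) ︔ α⇐ ︔ (φ ⊗₁ id {A})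
  lam-≋ = cast-dropˡ ρ⇐-IsCast ⊙ sym-assoc-≋ ⊙ sym-assoc-≋
        ⊙ (≋-sym (id⊗-︔-≋ ⊙ (≋-refl ︔≋ id⊗-︔-≋) ⊙ sym-assoc-≋) ︔≋ ≋-refl)

  app-≋ : app ≋ (φ⁻¹ ⊗₁ id {A}) ︔ α⇒ ︔ (id {A} ⊗₁ ε A)
  app-≋ = ≋-refl ︔≋ ≋-refl ︔≋ cast-dropʳ ρ⇒-IsCast

  φ-cancels-across-σ : ((φ ⊗₁ id) ⊗₁ id) ︔ α⇒ ︔ (id ⊗₁ σ A A) ︔ α⇐ ︔ ((φ⁻¹ ⊗₁ id) ⊗₁ id)
                     ≈ α⇒ ︔ (id ⊗₁ σ A A) ︔ α⇐
  φ-cancels-across-σ =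
    pullˡ ⊗-assoc₁ ∙ ︔-assoc ∙ refl⟩︔⟨ ((refl⟩⊗⟨ ⊗-id) ⟩︔⟨refl)
    ∙ refl⟩︔⟨ (pullˡ interchange ∙ ︔-assoc)
    ∙ refl⟩︔⟨ refl⟩︔⟨ refl⟩︔⟨ α⇐-natural
    ∙ refl⟩︔⟨ refl⟩︔⟨ refl⟩︔⟨ ((refl⟩⊗⟨ ⊗-id) ⟩︔⟨refl)
    ∙ refl⟩︔⟨ refl⟩︔⟨ cancelˡ (⊗id-inverse φ-isoˡ)

  -- φ ⊗ A and φ⁻¹ ⊗ A meet across the braiding of the two rightmost strands and cancel,
  -- which leaves A ⊗ curl.
  lam-app-β : (lam ⊗₁ id {A}) ︔ α⇒ ︔ (id {A} ⊗₁ σ A A) ︔ α⇐ ︔ (app ⊗₁ id {A}) ≋ id {A} ⊗₁ θ A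
  lam-app-β = begin≋
    (lam ⊗₁ id) ︔ α⇒ ︔ (id ⊗₁ σ A A) ︔ α⇐ ︔ (app ⊗₁ id)
      ≋⟨ ((lam-≋ ⊗≋ ≋-refl) ⊙ ︔-⊗id-≋ ⊙ (≋-refl ︔≋ ︔-⊗id-≋))
         ︔≋ ≋-refl ︔≋ ≋-refl ︔≋ ≋-refl ︔≋ ((app-≋ ⊗≋ ≋-refl) ⊙ ︔-⊗id-≋ ⊙ (≋-refl ︔≋ ︔-⊗id-≋)) ⟩
    (((id ⊗₁ η′ A) ⊗₁ id) ︔ (α⇐ ⊗₁ id) ︔ ((φ ⊗₁ id) ⊗₁ id)) ︔ α⇒ ︔ (id ⊗₁ σ A A) ︔ α⇐
      ︔ (((φ⁻¹ ⊗₁ id) ⊗₁ id) ︔ (α⇒ ⊗₁ id) ︔ ((id ⊗₁ ε A) ⊗₁ id))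
      ≋⟨ reassociate ⟩
    ((id ⊗₁ η′ A) ⊗₁ id)
      ︔ ((α⇐ ⊗₁ id) ︔ (((φ ⊗₁ id) ⊗₁ id) ︔ α⇒ ︔ (id ⊗₁ σ A A) ︔ α⇐ ︔ ((φ⁻¹ ⊗₁ id) ⊗₁ id)) ︔ (α⇒ ⊗₁ id))
      ︔ ((id ⊗₁ ε A) ⊗₁ id)
      ≋⟨ ≋-refl ︔≋ ((≋-refl ︔≋ (≈⇒≋ φ-cancels-across-σ ︔≋ ≋-refl)) ︔≋ ≋-refl) ⟩
    ((id ⊗₁ η′ A) ⊗₁ id) ︔ ((α⇐ ⊗₁ id) ︔ (α⇒ ︔ (id ⊗₁ σ A A) ︔ α⇐) ︔ (α⇒ ⊗₁ id)) ︔ ((id ⊗₁ ε A) ⊗₁ id)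
      ≋⟨ ⊗-assoc-≋ ︔≋ middle ︔≋ ⊗-assoc-≋ ⟩
    (id ⊗₁ (η′ A ⊗₁ id)) ︔ (id ⊗₁ (α⇒ ︔ (id ⊗₁ σ A A) ︔ α⇐)) ︔ (id ⊗₁ (ε A ⊗₁ id))
      ≋⟨ (≋-refl ︔≋ ≋-sym id⊗-︔-≋) ⊙ ≋-sym id⊗-︔-≋ ⟩
    id ⊗₁ ((η′ A ⊗₁ id) ︔ (α⇒ ︔ (id ⊗₁ σ A A) ︔ α⇐) ︔ (ε A ⊗₁ id))
      ≋⟨ ≋-refl ⊗≋ ((≋-refl ︔≋ (assoc-≋ ⊙ (≋-refl ︔≋ assoc-≋))) ⊙ curl≋θ) ⟩
    id ⊗₁ θ A ≋∎
    where
      reassociate =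
        (assoc-≋ ⊙ (≋-refl ︔≋ assoc-≋))
        ⊙ ≋-sym ((≋-refl ︔≋ assoc-≋) ⊙ (≋-refl ︔≋ ≋-refl ︔≋ assoc-≋)
                 ⊙ (≋-refl ︔≋ ≋-refl ︔≋ (assoc-≋ ⊙ (≋-refl ︔≋ assoc-≋) ⊙ (≋-refl ︔≋ ≋-refl ︔≋ assoc-≋)
                                          ⊙ (≋-refl ︔≋ ≋-refl ︔≋ ≋-refl ︔≋ assoc-≋))))
      middle =
        (≋-refl ︔≋ (assoc-≋ ⊙ (≋-refl ︔≋ assoc-≋))) ⊙ sym-assoc-≋
        ⊙ (casts-≋ ((α⇐-IsCast ⊗-IsCast id-IsCast) ︔-IsCast α⇒-IsCast) (id-IsCast ⊗-IsCast α⇒-IsCast) ⊗-assoc₀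
           ︔≋ ((≋-sym ⊗-id-≋ ⊗≋ ≋-refl) ⊙ ⊗-assoc-≋)
           ︔≋ casts-≋ (α⇐-IsCast ︔-IsCast (α⇒-IsCast ⊗-IsCast id-IsCast)) (id-IsCast ⊗-IsCast α⇐-IsCast) ⊗-assoc₀)
        ⊙ ≋-sym (id⊗-︔-≋ ⊙ (≋-refl ︔≋ id⊗-︔-≋))

  lam-app-β-⊗id :
    (lam ⊗₁ id {A ⊗₀ Y}) ︔ α⇒ ︔ (id ⊗₁ α⇐) ︔ (id ⊗₁ (σ A A ⊗₁ id)) ︔ (id ⊗₁ α⇒) ︔ α⇐ ︔ (app ⊗₁ id)
    ≋ id {A} ⊗₁ (θ A ⊗₁ id {Y})
  lam-app-β-⊗id =
    (≋-refl ︔≋ sym-assoc-≋) ⊙ (≋-refl ︔≋ ≋-refl ︔≋ ≋-refl ︔≋ sym-assoc-≋)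
    ⊙ (≋-sym (⊗-assoc-≋ ⊙ (≋-refl ⊗≋ ⊗-id-≋))
       ︔≋ casts-≋ (α⇒-IsCast ︔-IsCast (id-IsCast ⊗-IsCast α⇐-IsCast)) (α⇒-IsCast ⊗-IsCast id-IsCast) (sym ⊗-assoc₀)
       ︔≋ ⊗-sym-assoc-≋
       ︔≋ casts-≋ ((id-IsCast ⊗-IsCast α⇒-IsCast) ︔-IsCast α⇐-IsCast) (α⇐-IsCast ⊗-IsCast id-IsCast) (sym ⊗-assoc₀)
       ︔≋ ≋-sym (⊗-assoc-≋ ⊙ (≋-refl ⊗≋ ⊗-id-≋)))
    ⊙ ≋-sym (︔-⊗id-≋ ⊙ (≋-refl ︔≋ (︔-⊗id-≋ ⊙ (≋-refl ︔≋ (︔-⊗id-≋ ⊙ (≋-refl ︔≋ ︔-⊗id-≋))))))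
    ⊙ (lam-app-β ⊗≋ ≋-refl) ⊙ ⊗-assoc-≋

  lam-app-β-⊗ : (((lam ⊗₁ id {Y}) ︔ α⇒) ⊗₁ id {A}) ︔ α⇒ ︔ (id ⊗₁ σ (A ⊗₀ Y) A) ︔ α⇐ ︔ (app ⊗₁ id)
              ≋ (id {A} ⊗₁ σ Y A) ︔ (id ⊗₁ (θ A ⊗₁ id {Y}))
  lam-app-β-⊗ {Y} = begin≋
    (((lam ⊗₁ id) ︔ α⇒) ⊗₁ id) ︔ α⇒ ︔ (id ⊗₁ σ (A ⊗₀ Y) A) ︔ α⇐ ︔ (app ⊗₁ id)
      ≋⟨ (︔-⊗id-≋ ︔≋ ≋-refl) ⊙ assoc-≋ ⊙ (≋-refl ︔≋ ≋-refl ︔≋ ≋-refl ︔≋ (≈⇒≋ hexagon-inside ︔≋ ≋-refl)) ⟩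
    L ︔ (α⇒ ⊗₁ id) ︔ α⇒ ︔ ((id ⊗₁ α⇒) ︔ (id ⊗₁ (id ⊗₁ σ Y A)) ︔ (id ⊗₁ α⇐) ︔ (id ⊗₁ (σ A A ⊗₁ id)) ︔ (id ⊗₁ α⇒))
      ︔ α⇐ ︔ (app ⊗₁ id)
      ≋⟨ ≋-refl ︔≋ ≋-refl ︔≋ ≋-refl ︔≋ flatten ⟩
    L ︔ (α⇒ ⊗₁ id) ︔ α⇒ ︔ (id ⊗₁ α⇒) ︔ (id ⊗₁ (id ⊗₁ σ Y A)) ︔ (id ⊗₁ α⇐) ︔ (id ⊗₁ (σ A A ⊗₁ id)) ︔ (id ⊗₁ α⇒)
      ︔ α⇐ ︔ (app ⊗₁ id)
      ≋⟨ reassociate ⟩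
    (L ︔ (α⇒ ⊗₁ id) ︔ α⇒ ︔ (id ⊗₁ α⇒) ︔ (id ⊗₁ (id ⊗₁ σ Y A)))
      ︔ (id ⊗₁ α⇐) ︔ (id ⊗₁ (σ A A ⊗₁ id)) ︔ (id ⊗₁ α⇒) ︔ α⇐ ︔ (app ⊗₁ id)
      ≋⟨ braid-first ︔≋ ≋-refl ⟩
    ((id ⊗₁ σ Y A) ︔ (lam ⊗₁ id) ︔ α⇒)
      ︔ (id ⊗₁ α⇐) ︔ (id ⊗₁ (σ A A ⊗₁ id)) ︔ (id ⊗₁ α⇒) ︔ α⇐ ︔ (app ⊗₁ id)
      ≋⟨ assoc-≋ ⊙ (≋-refl ︔≋ assoc-≋) ⊙ (≋-refl ︔≋ lam-app-β-⊗id) ⟩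
    (id ⊗₁ σ Y A) ︔ (id ⊗₁ (θ A ⊗₁ id)) ≋∎
    where
      L = (lam ⊗₁ id {Y}) ⊗₁ id {A}
      hexagon-inside : id {A} ⊗₁ σ (A ⊗₀ Y) A
                     ≈ (id ⊗₁ α⇒) ︔ (id ⊗₁ (id ⊗₁ σ Y A)) ︔ (id ⊗₁ α⇐) ︔ (id ⊗₁ (σ A A ⊗₁ id)) ︔ (id ⊗₁ α⇒)
      hexagon-inside = refl⟩⊗⟨ hexagon₂ ∙ id⊗-︔ ∙ refl⟩︔⟨ (id⊗-︔ ∙ refl⟩︔⟨ (id⊗-︔ ∙ refl⟩︔⟨ id⊗-︔))
      flatten = assoc-≋ ⊙ (≋-refl ︔≋ assoc-≋) ⊙ (≋-refl ︔≋ ≋-refl ︔≋ assoc-≋)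
              ⊙ (≋-refl ︔≋ ≋-refl ︔≋ ≋-refl ︔≋ assoc-≋)
      reassociate = (≋-refl ︔≋ ≋-refl ︔≋ ≋-refl ︔≋ sym-assoc-≋) ⊙ (≋-refl ︔≋ ≋-refl ︔≋ sym-assoc-≋)
                  ⊙ (≋-refl ︔≋ sym-assoc-≋) ⊙ sym-assoc-≋
      braid-first : L ︔ (α⇒ ⊗₁ id) ︔ α⇒ ︔ (id ⊗₁ α⇒) ︔ (id ⊗₁ (id ⊗₁ σ Y A))
                  ≋ (id {A} ⊗₁ σ Y A) ︔ (lam ⊗₁ id {A ⊗₀ Y}) ︔ α⇒
      braid-first =
        ((⊗-assoc-≋ ⊙ (≋-refl ⊗≋ ⊗-id-≋))
         ︔≋ (sym-assoc-≋ ⊙ sym-assoc-≋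
             ⊙ cast-dropˡ (((α⇒-IsCast ⊗-IsCast id-IsCast) ︔-IsCast α⇒-IsCast) ︔-IsCast (id-IsCast ⊗-IsCast α⇒-IsCast))
             ⊙ ⊗-sym-assoc-≋ ⊙ (⊗-id-≋ ⊗≋ ≋-refl) ⊙ ≋-sym (cast-dropʳ α⇒-IsCast)))
        ⊙ sym-assoc-≋ ⊙ (≈⇒≋ interchange ︔≋ ≋-refl) ⊙ assoc-≋

  app-lam-counit : (g : (A ⊗₀ Y) ⇒ I) →
                   (((lam ⊗₁ id {Y}) ︔ α⇒ ︔ (id {A} ⊗₁ g) ︔ ρ⇒) ⊗₁ id {A}) ︔ app
                   ≋ id {A} ⊗₁ (σ Y A ︔ (θ A ⊗₁ id {Y}) ︔ g)
  app-lam-counit g =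
    ((sym-assoc-≋ ⊗≋ ≋-refl) ︔≋ ≋-refl) ⊙ postpone-counit ((lam ⊗₁ id) ︔ α⇒) g
    ⊙ (≋-refl ︔≋ ≋-refl ︔≋ ≋-refl ︔≋ sym-assoc-≋) ⊙ (≋-refl ︔≋ ≋-refl ︔≋ sym-assoc-≋)
    ⊙ (≋-refl ︔≋ sym-assoc-≋) ⊙ sym-assoc-≋
    ⊙ (lam-app-β-⊗ ︔≋ ≋-refl) ⊙ assoc-≋ ⊙ ≋-sym (id⊗-︔-≋ ⊙ (≋-refl ︔≋ id⊗-︔-≋))

  Λ : ∀ k → ((A^ k ⊗₀ X) ⇒ I) → (A ⊗₀ X) ⇒ A
  Λ k q = (lamₘ k ⊗₁ id) ︔ α⇒ ︔ (id {A} ⊗₁ q) ︔ ρ⇒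

  shift : ∀ k → ((A^ (suc k) ⊗₀ X) ⇒ I) → (A^ k ⊗₀ (X ⊗₀ A)) ⇒ I
  shift {X} k q = α⇐ ︔ σ (A^ k ⊗₀ X) A ︔ (θ A ⊗₁ id) ︔ α⇐ ︔ q

  unshift : ∀ k → ((A^ k ⊗₀ (X ⊗₀ A)) ⇒ I) → (A^ (suc k) ⊗₀ X) ⇒ I
  unshift {X} k r = α⇒ ︔ (θ⁻¹ A ⊗₁ id) ︔ σ⁻¹ (A^ k ⊗₀ X) A ︔ α⇒ ︔ r

  unshift-shift : ∀ k (q : (A^ (suc k) ⊗₀ X) ⇒ I) → unshift k (shift k q) ≈ q
  unshift-shift k q =
    refl⟩︔⟨ refl⟩︔⟨ refl⟩︔⟨ cancelˡ (cast-inverse α⇒-IsCast α⇐-IsCast)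
    ∙ refl⟩︔⟨ refl⟩︔⟨ cancelˡ σ-isoʳ
    ∙ refl⟩︔⟨ cancelˡ (⊗id-inverse θ-isoʳ)
    ∙ cancelˡ (cast-inverse α⇒-IsCast α⇐-IsCast)

  shift-unshift : ∀ k (r : (A^ k ⊗₀ (X ⊗₀ A)) ⇒ I) → shift k (unshift k r) ≈ r
  shift-unshift k r =
    refl⟩︔⟨ refl⟩︔⟨ refl⟩︔⟨ cancelˡ (cast-inverse α⇐-IsCast α⇒-IsCast)
    ∙ refl⟩︔⟨ refl⟩︔⟨ cancelˡ (⊗id-inverse θ-isoˡ)
    ∙ refl⟩︔⟨ cancelˡ σ-isoˡ
    ∙ cancelˡ (cast-inverse α⇐-IsCast α⇒-IsCast)

  shift-injective : ∀ k {q q′ : (A^ (suc k) ⊗₀ X) ⇒ I} → shift k q ≈ shift k q′ → q ≈ q′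
  shift-injective k {q} {q′} p =
    ≈-sym (unshift-shift k q) ∙ refl⟩︔⟨ refl⟩︔⟨ refl⟩︔⟨ refl⟩︔⟨ p ∙ unshift-shift k q′

  Λ-suc : ∀ k (q : (A^ (suc k) ⊗₀ X) ⇒ I) →
          Λ (suc k) q ≋ (lamₘ k ⊗₁ id) ︔ α⇒ ︔ ((lam ⊗₁ id) ︔ α⇒ ︔ (id {A} ⊗₁ (α⇐ ︔ q)) ︔ ρ⇒)
  Λ-suc k q = begin≋
    Λ (suc k) q ≋⟨ ((︔-⊗id-≋ ⊙ (≋-refl ︔≋ ︔-⊗id-≋)) ︔≋ ≋-refl) ⊙ assoc-≋ ⊙ (≋-refl ︔≋ assoc-≋) ⟩
    (lamₘ k ⊗₁ id) ︔ ((lam ⊗₁ id) ⊗₁ id) ︔ (α⇒ ⊗₁ id) ︔ α⇒ ︔ (id ⊗₁ q) ︔ ρ⇒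
      ≋⟨ ≋-refl ︔≋ (((⊗-assoc-≋ ⊙ (≋-refl ⊗≋ ⊗-id-≋) ⊙ ≋-sym (cast-dropˡ α⇒-IsCast))
                     ︔≋ (sym-assoc-≋
                         ⊙ (casts-≋ ((α⇒-IsCast ⊗-IsCast id-IsCast) ︔-IsCast α⇒-IsCast)
                                    (α⇒-IsCast ︔-IsCast (id-IsCast ⊗-IsCast α⇐-IsCast)) ⊗-assoc₀ ︔≋ ≋-refl)
                         ⊙ assoc-≋ ⊙ (≋-refl ︔≋ sym-assoc-≋) ⊙ (≋-refl ︔≋ (≋-sym id⊗-︔-≋ ︔≋ ≋-refl))))
                    ⊙ assoc-≋) ⟩
    (lamₘ k ⊗₁ id) ︔ α⇒ ︔ (lam ⊗₁ id) ︔ α⇒ ︔ (id ⊗₁ (α⇐ ︔ q)) ︔ ρ⇒ ≋∎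

  app-Λ-suc : ∀ k (q : (A^ (suc k) ⊗₀ X) ⇒ I) → (Λ (suc k) q ⊗₁ id {A}) ︔ app ≋ Λ k (shift k q)
  app-Λ-suc {X} k q = begin≋
    (Λ (suc k) q ⊗₁ id) ︔ app ≋⟨ (Λ-suc k q ⊗≋ ≋-refl) ︔≋ ≋-refl ⟩
    (((lamₘ k ⊗₁ id {X}) ︔ α⇒ ︔ abstraction) ⊗₁ id) ︔ app
      ≋⟨ (((sym-assoc-≋ ⊗≋ ≋-refl) ⊙ ︔-⊗id-≋) ︔≋ ≋-refl) ⊙ assoc-≋
         ⊙ (≋-refl ︔≋ (app-lam-counit (α⇐ ︔ q) ⊙ ≋-sym (cast-dropˡ α⇒-IsCast))) ⟩
    (((lamₘ k ⊗₁ id {X}) ︔ α⇒) ⊗₁ id) ︔ α⇒ ︔ (id ⊗₁ (σ (A^ k ⊗₀ X) A ︔ (θ A ⊗₁ id) ︔ α⇐ ︔ q))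
      ≋⟨ ((︔-⊗id-≋ ︔≋ ≋-refl) ⊙ assoc-≋)
         ⊙ ((⊗-assoc-≋ ⊙ (≋-refl ⊗≋ ⊗-id-≋))
            ︔≋ (sym-assoc-≋
                ⊙ (casts-≋ ((α⇒-IsCast ⊗-IsCast id-IsCast) ︔-IsCast α⇒-IsCast)
                           (α⇒-IsCast ︔-IsCast (id-IsCast ⊗-IsCast α⇐-IsCast)) ⊗-assoc₀
                   ︔≋ ≋-sym (cast-dropʳ ρ⇒-IsCast))
                ⊙ assoc-≋ ⊙ (≋-refl ︔≋ sym-assoc-≋) ⊙ (≋-refl ︔≋ (≋-sym id⊗-︔-≋ ︔≋ ≋-refl)))) ⟩
    Λ k (shift k q) ≋∎
    where
      abstraction = (lam ⊗₁ id {A^ k ⊗₀ X}) ︔ α⇒ ︔ (id {A} ⊗₁ (α⇐ ︔ q)) ︔ ρ⇒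

  Λ-cast : ∀ k {c : X ⇒ Y} → IsCast c → (r : (A^ k ⊗₀ Y) ⇒ I) → Λ k ((id ⊗₁ c) ︔ r) ≋ Λ k r
  Λ-cast k c r =
    (≋-refl ⊗≋ id≋id (obj-eq c))
    ︔≋ casts-≋ α⇒-IsCast α⇒-IsCast (cong ((A ⊗₀ A^ k) ⊗₀_) (obj-eq c))
    ︔≋ (≋-refl ⊗≋ cast-dropˡ (id-IsCast ⊗-IsCast c)) ︔≋ ≋-refl

  curry : ∀ k → ((A^ k ⊗₀ ((A *) ⊗₀ X)) ⇒ I) → X ⇒ A
  curry k q = λ⇐ ︔ (η A ⊗₁ id) ︔ α⇒ ︔ Λ k q

  curry-zero : (q : (I ⊗₀ ((A *) ⊗₀ X)) ⇒ I) → curry 0 q ≈ η-transpose (λ⇐ ︔ q)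
  curry-zero q = refl⟩︔⟨ refl⟩︔⟨ refl⟩︔⟨
    (sym-assoc
     ∙ casts-equal ((ρ⇐-IsCast ⊗-IsCast id-IsCast) ︔-IsCast α⇒-IsCast) (id-IsCast ⊗-IsCast λ⇐-IsCast) ⟩︔⟨refl
     ∙ pullˡ (≈-sym id⊗-︔))

  shift′ : ∀ k → ((A^ (suc k) ⊗₀ ((A *) ⊗₀ X)) ⇒ I) → (A^ k ⊗₀ ((A *) ⊗₀ (X ⊗₀ A))) ⇒ I
  shift′ k q = (id ⊗₁ α⇐) ︔ shift k q

  app-curry-suc : ∀ k (q : (A^ (suc k) ⊗₀ ((A *) ⊗₀ X)) ⇒ I) →
                  (curry (suc k) q ⊗₁ id {A}) ︔ app ≋ curry k (shift′ k q)
  app-curry-suc k q =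
    (((sym-assoc-≋ ⊙ sym-assoc-≋) ⊗≋ ≋-refl) ︔≋ ≋-refl) ⊙ ((︔-⊗id-≋ ︔≋ ≋-refl) ⊙ assoc-≋)
    ⊙ (≋-refl ︔≋ (app-Λ-suc k q ⊙ ≋-sym (cast-dropˡ α⇒-IsCast)))
    ⊙ ((︔-⊗id-≋ ⊙ (︔-⊗id-≋ ︔≋ ≋-refl)) ︔≋ ≋-refl) ⊙ assoc-≋ ⊙ assoc-≋
    ⊙ (casts-≋ (λ⇐-IsCast ⊗-IsCast id-IsCast) λ⇐-IsCast refl
       ︔≋ (⊗-assoc-≋ ⊙ (≋-refl ⊗≋ ⊗-id-≋))
       ︔≋ (sym-assoc-≋ ⊙ (casts-≋ ((α⇒-IsCast ⊗-IsCast id-IsCast) ︔-IsCast α⇒-IsCast) α⇒-IsCast ⊗-assoc₀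
                          ︔≋ ≋-sym (Λ-cast k α⇐-IsCast (shift k q)))))

  shift′-injective : ∀ k {q q′ : (A^ (suc k) ⊗₀ ((A *) ⊗₀ X)) ⇒ I} → shift′ k q ≈ shift′ k q′ → q ≈ q′
  shift′-injective k p =
    shift-injective k (︔-cancelˡ (cast-inverse (id-IsCast ⊗-IsCast α⇒-IsCast) (id-IsCast ⊗-IsCast α⇐-IsCast)) p)

  curry-injective : ∀ k {q q′ : (A^ k ⊗₀ ((A *) ⊗₀ X)) ⇒ I} → curry k q ≈ curry k q′ → q ≈ q′
  curry-injective zero {q} {q′} p =
    ︔-cancelˡ (cast-inverse λ⇒-IsCast λ⇐-IsCast)
      (η-transpose-injective (≈-sym (curry-zero q) ∙ p ∙ curry-zero q′))
  curry-injective (suc k) {q} {q′} p =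
    shift′-injective k (curry-injective k
      (≋⇒≈ (≋-sym (app-curry-suc k q) ⊙ ≈⇒≋ (p ⟩⊗⟨refl ⟩︔⟨refl) ⊙ app-curry-suc k q′)))

  ε′ : (A ⊗₀ (A *)) ⇒ I
  ε′ = σ A (A *) ︔ (id ⊗₁ θ A) ︔ ε A

  bend : ∀ k → (A^ k ⇒ A) → (A^ k ⊗₀ ((A *) ⊗₀ I)) ⇒ I
  bend k M = (id ⊗₁ ρ⇒) ︔ (M ⊗₁ id) ︔ ε′

  bend≈ε-transpose : ∀ k (M : A^ k ⇒ A) →
                     bend k M ≈ ((id ⊗₁ ρ⇒) ︔ σ (A^ k) (A *)) ︔ ε-transpose (M ︔ θ A)
  bend≈ε-transpose k M =
    refl⟩︔⟨ (pullˡ σ-natural ∙ ︔-assoc ∙ refl⟩︔⟨ pullˡ (≈-sym id⊗-︔)) ∙ sym-assoc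

  bend-injective : ∀ k {M M′ : A^ k ⇒ A} → bend k M ≈ bend k M′ → M ≈ M′
  bend-injective k {M} {M′} p =
    ︔-cancelʳ θ-isoˡ (ε-transpose-injective
      (︔-cancelˡ unbraid (≈-sym (bend≈ε-transpose k M) ∙ p ∙ bend≈ε-transpose k M′)))
    where
      unbraid : (σ⁻¹ (A^ k) (A *) ︔ (id ⊗₁ ρ⇐)) ︔ ((id ⊗₁ ρ⇒) ︔ σ (A^ k) (A *)) ≈ id
      unbraid = ︔-assoc
              ∙ refl⟩︔⟨ cancelˡ (cast-inverse (id-IsCast ⊗-IsCast ρ⇐-IsCast) (id-IsCast ⊗-IsCast ρ⇒-IsCast))
              ∙ σ-isoʳ

  closed-trace : (A ⇒ (A ⊗₀ A)) → I ⇒ A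
  closed-trace h = η A ︔ (h ⊗₁ id {A *}) ︔ α⇒ ︔ (id {A} ⊗₁ ε′) ︔ ρ⇒

  Tr≋closed-trace : (h : A ⇒ (A ⊗₀ A)) → Tr A (λ⇒ ︔ h) ≋ closed-trace h
  Tr≋closed-trace h =
    (≋-refl ︔≋ ≋-refl ︔≋ ≋-refl ︔≋ (︔-⊗id-≋ ︔≋ ≋-refl)) ⊙ (≋-refl ︔≋ ≋-refl ︔≋ ≋-refl ︔≋ assoc-≋)
    ⊙ (≋-refl ︔≋ ≋-refl ︔≋ sym-assoc-≋) ⊙ (≋-refl ︔≋ sym-assoc-≋) ⊙ sym-assoc-≋
    ⊙ ((cast-dropˡ ρ⇐-IsCast ⊙ cast-dropʳ (α⇐-IsCast ︔-IsCast (λ⇒-IsCast ⊗-IsCast id-IsCast)) ⊙ unitˡ-≋) ︔≋ ≋-refl)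

  curry-bend≋closed-trace : ∀ k (M : A^ k ⇒ A) → curry k (bend k M) ≋ closed-trace (lamₘ k ︔ (id {A} ⊗₁ M))
  curry-bend≋closed-trace k M =
    (≋-refl ︔≋ ≋-refl ︔≋ ≋-refl ︔≋ ≋-refl ︔≋ ≋-refl ︔≋ ((id⊗-︔-≋ ⊙ (≋-refl ︔≋ id⊗-︔-≋)) ︔≋ ≋-refl))
    ⊙ (≋-refl ︔≋ ≋-refl ︔≋ ≋-refl ︔≋ ≋-refl ︔≋ ((≋-refl ︔≋ assoc-≋) ⊙ (≋-refl ︔≋ ≋-refl ︔≋ assoc-≋)
                                                  ⊙ (≋-refl ︔≋ sym-assoc-≋) ⊙ sym-assoc-≋))
    ⊙ (≋-refl ︔≋ sym-assoc-≋) ⊙ sym-assoc-≋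
    ⊙ ((cast-dropˡ λ⇐-IsCast ⊙ cast-dropʳ α⇒-IsCast ⊙ unitʳ-≋)
       ︔≋ (≋-refl ⊗≋ id≋id ⊗-unitʳ₀)
       ︔≋ ((cast-dropˡ α⇒-IsCast ⊙ cast-dropˡ (id-IsCast ⊗-IsCast (id-IsCast ⊗-IsCast ρ⇒-IsCast))
            ⊙ ⊗-sym-assoc-≋ ⊙ ≋-sym (cast-dropʳ α⇒-IsCast)) ︔≋ ≋-refl))
    ⊙ (≋-refl ︔≋ ≋-refl ︔≋ assoc-≋)
    ⊙ ≋-sym (≋-refl ︔≋ ((︔-⊗id-≋ ︔≋ ≋-refl) ⊙ assoc-≋))

  body : ∀ {m n} → (A^ m ⇒ A^ n) → A^ (suc m) ⇒ A
  body {n = n} f = (id {A} ⊗₁ f) ︔ appₙ n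

  F-integrand : ∀ {m n} (f : A^ m ⇒ A^ n) →
                lamₘ m ︔ (lam ⊗₁ f) ︔ α⇒ ︔ (id {A} ⊗₁ appₙ n) ≈ lamₘ (suc m) ︔ (id {A} ⊗₁ body {m} {n} f)
  F-integrand f =
    refl⟩︔⟨ (⊗≈⊗id︔id⊗ ⟩︔⟨refl ∙ ︔-assoc)
    ∙ refl⟩︔⟨ refl⟩︔⟨ (pullˡ ((≈-sym ⊗-id ⟩⊗⟨refl) ⟩︔⟨refl ∙ ⊗-assoc₁) ∙ ︔-assoc)
    ∙ refl⟩︔⟨ refl⟩︔⟨ refl⟩︔⟨ ≈-sym id⊗-︔
    ∙ ≈-sym (︔-assoc ∙ refl⟩︔⟨ ︔-assoc)

  F≈curry-bend-body : ∀ {m n} (f : A^ m ⇒ A^ n) → F {m} {n} f ≈ curry (suc m) (bend (suc m) (body {m} {n} f))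
  F≈curry-bend-body {m} {n} f = ≋⇒≈ (
    Tr≋closed-trace _ ⊙ ≈⇒≋ (refl⟩︔⟨ (F-integrand {m} {n} f ⟩⊗⟨refl ⟩︔⟨refl))
    ⊙ ≋-sym (curry-bend≋closed-trace (suc m) (body {m} {n} f)))

  F-determines-body : ∀ m n (f g : A^ m ⇒ A^ n) → F {m} {n} f ≈ F {m} {n} g → body {m} {n} f ≈ body {m} {n} g
  F-determines-body m n f g p =
    bend-injective (suc m) (curry-injective (suc m)
      (≈-sym (F≈curry-bend-body {m} {n} f) ∙ p ∙ F≈curry-bend-body {m} {n} g))

  shiftⁿ : ∀ n → ((A^ n ⊗₀ X) ⇒ I) → (X ⊗₀ A^ n) ⇒ I
  shiftⁿ zero q = ρ⇒ ︔ λ⇐ ︔ q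
  shiftⁿ (suc n) q = α⇐ ︔ shiftⁿ n (shift n q)

  shiftⁿ-resp : ∀ n {q q′ : (A^ n ⊗₀ X) ⇒ I} → q ≈ q′ → shiftⁿ n q ≈ shiftⁿ n q′
  shiftⁿ-resp zero p = refl⟩︔⟨ refl⟩︔⟨ p
  shiftⁿ-resp (suc n) p = refl⟩︔⟨ shiftⁿ-resp n (refl⟩︔⟨ refl⟩︔⟨ refl⟩︔⟨ refl⟩︔⟨ p)

  shiftⁿ-surjective : ∀ n (r : (X ⊗₀ A^ n) ⇒ I) → Σ[ q ∈ (A^ n ⊗₀ X) ⇒ I ] shiftⁿ n q ≈ r
  shiftⁿ-surjective zero r =
    λ⇒ ︔ ρ⇐ ︔ r , refl⟩︔⟨ cancelˡ (cast-inverse λ⇐-IsCast λ⇒-IsCast) ∙ cancelˡ (cast-inverse ρ⇒-IsCast ρ⇐-IsCast)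
  shiftⁿ-surjective (suc n) r with shiftⁿ-surjective n (α⇒ ︔ r)
  ... | q , shiftⁿq≈α⇒r =
    unshift n q , refl⟩︔⟨ (shiftⁿ-resp n (shift-unshift n q) ∙ shiftⁿq≈α⇒r)
                  ∙ cancelˡ (cast-inverse α⇐-IsCast α⇒-IsCast)

  appₙ-Λ : ∀ n (q : (A^ n ⊗₀ X) ⇒ I) → (Λ n q ⊗₁ id {A^ n}) ︔ appₙ n ≋ id {A} ⊗₁ shiftⁿ n q
  appₙ-Λ zero q =
    cast-dropʳ ρ⇒-IsCast ⊙ unitʳ-≋ ⊙ sym-assoc-≋ ⊙ cast-dropˡ ((ρ⇐-IsCast ⊗-IsCast id-IsCast) ︔-IsCast α⇒-IsCast)
    ⊙ cast-dropʳ ρ⇒-IsCast ⊙ (≋-refl ⊗≋ ≋-sym (sym-assoc-≋ ⊙ cast-dropˡ (ρ⇒-IsCast ︔-IsCast λ⇐-IsCast)))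
  appₙ-Λ (suc n) q =
    sym-assoc-≋ ⊙ ((cast-dropʳ α⇐-IsCast ⊙ (≋-refl ⊗≋ ≋-sym ⊗-id-≋) ⊙ ⊗-sym-assoc-≋) ︔≋ ≋-refl)
    ⊙ sym-assoc-≋ ⊙ (≋-sym ︔-⊗id-≋ ︔≋ ≋-refl)
    ⊙ (((app-Λ-suc n q ⊙ ≋-sym (cast-dropˡ α⇒-IsCast)) ⊗≋ ≋-refl) ︔≋ ≋-refl) ⊙ (︔-⊗id-≋ ︔≋ ≋-refl) ⊙ assoc-≋
    ⊙ cast-dropˡ (α⇒-IsCast ⊗-IsCast id-IsCast) ⊙ appₙ-Λ n (shift n q) ⊙ (≋-refl ⊗≋ ≋-sym (cast-dropˡ α⇐-IsCast))

  body-determines-id⊗-ε-transpose : ∀ m n (f g : A^ m ⇒ A^ n) → body {m} {n} f ≈ body {m} {n} g →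
                                    id {A} ⊗₁ ε-transpose f ≈ id ⊗₁ ε-transpose g
  body-determines-id⊗-ε-transpose m n f g p = ≋⇒≈ (≋-sym (Λq-body f) ⊙ ≈⇒≋ (refl⟩︔⟨ p) ⊙ Λq-body g)
    where
      q : (A^ n ⊗₀ ((A^ n) *)) ⇒ I
      q = proj₁ (shiftⁿ-surjective n (ε (A^ n)))
      shiftⁿq≈ε : shiftⁿ n q ≈ ε (A^ n)
      shiftⁿq≈ε = proj₂ (shiftⁿ-surjective n (ε (A^ n)))
      Λq-body : ∀ u → (Λ n q ⊗₁ id {A^ m}) ︔ body {m} {n} u ≋ id {A} ⊗₁ ε-transpose u
      Λq-body u =
        ≈⇒≋ (pullˡ interchange ∙ ︔-assoc)
        ⊙ (≋-refl ︔≋ (appₙ-Λ n q ⊙ (≋-refl ⊗≋ ≈⇒≋ shiftⁿq≈ε)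
                      ⊙ ≋-sym (cast-dropˡ α⇒-IsCast)))
        ⊙ ((((≋-sym ⊗-id-≋ ⊗≋ ≋-refl) ⊙ ⊗-assoc-≋) ︔≋ cast-dropˡ α⇒-IsCast) ⊙ ≋-sym id⊗-︔-≋)

  body-determines-A⊗ : ∀ m n (f g : A^ m ⇒ A^ n) → body {m} {n} f ≈ body {m} {n} g → id {A} ⊗₁ f ≈ id ⊗₁ g
  body-determines-A⊗ m n f g p = id⊗-ε-transpose-injective (body-determines-id⊗-ε-transpose m n f g p)

proposition6p9 : ∀ {o ℓ e} (𝒞 : StrictRibbonCategory o ℓ e) (R : ReflexiveObject 𝒞) →
                 Reflexive.A⊗-Faithful 𝒞 R → Reflexive.F-Faithful 𝒞 R
proposition6p9 𝒞 R A⊗-faithful m n f g Ff≈Fg =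
  A⊗-faithful m n f g (body-determines-A⊗ m n f g (F-determines-body m n f g Ff≈Fg))
  where open ReflexiveLemmas 𝒞 R
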